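{- Let $i\geq 3$ be an integer, let $D$ be an $(i,2)$ digraph, let $H$ be a hole of length $l \geq 5$ in $U(D)$, and let $C$ be the cycle in $P(D)$ obtained from $H$ by $\Gamma_H$, and suppose $C$ has length at least four. If $$ l - |\Gamma_H| \geq 2i+1 \quad\text{or}\quad l < 3|\Gamma_H|,$$ then the subgraph of $P(D)$ induced by $V(C)$ contains a hole.
   Context: An $(i,j)$ digraph is an acyclic digraph in which every vertex has indegree at most $i$ and outdegree at most $j$. $U(D)$ is the underlying graph of $D$ (edge $uv$ iff $(u,v)$ or $(v,u)$ is an arc). The phylogeny graph $P(D)$ has vertex set $V(D)$ and an edge between distinct $u,v$ iff $(u,v)\in A(D)$ or $(v,u)\in A(D)$ or $u,v$ have a common out-neighbor. A hole is an induced cycle of length at least $4$. For a hole $H=v_1\cdots v_lv_1$ of $U(D)$ with $l\ge 5$, $\Gamma_H$ is the set of vertices of $H$ with exactly two in-neighbors in the subdigraph $D_H$ of $D$ induced by $V(H)$ (no two consecutive on $H$), and the cycle obtained from $H$ by $\Gamma_H$ is the cycle in $P(D)$ on $V(H)-\Gamma_H$ in the cyclic order of $H$ (each path $v_{a-1}v_av_{a+1}$ with $v_a\in\Gamma_H$ replaced by the edge $v_{a-1}v_{a+1}$); it has length $l-|\Gamma_H|$. -}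

module Defs where

open import Data.Nat using (ℕ; zero; suc; _+_; _≤_; _≡ᵇ_)
open import Data.Fin using (Fin; zero; suc; toℕ; inject₁; fromℕ)
open import Data.Bool using (Bool; true; false; if_then_else_)
open import Data.Product using (Σ; _×_; ∃)
open import Data.Sum using (_⊎_)
open import Relation.Binary.PropositionalEquality using (_≡_; _≢_)
open import Function.Bundles using (_⇔_)

-- A digraph on vertex set Fin n, given by its (Boolean) arc relation:
-- D u v ≡ true  iff  (u,v) is an arc.
Digraph : ℕ → Set
Digraph n = Fin n → Fin n → Bool

count : ∀ {m} → (Fin m → Bool) → ℕ
count {zero}  p = 0
count {suc m} p = (if p zero then 1 else 0) + count (λ x → p (suc x))

indeg : ∀ {n} → Digraph n → Fin n → ℕ
indeg D v = count (λ u → D u v)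

outdeg : ∀ {n} → Digraph n → Fin n → ℕ
outdeg D v = count (λ w → D v w)

-- acyclic: no directed closed walk p0 → p1 → ... → p(k+1) = p0 of positive length
Acyclic : ∀ {n} → Digraph n → Set
Acyclic {n} D =
  ∀ k (p : Fin (suc (suc k)) → Fin n) →
  (∀ (j : Fin (suc k)) → D (p (inject₁ j)) (p (suc j)) ≡ true) →
  p zero ≢ p (fromℕ (suc k))

IJDigraph : ℕ → ℕ → ∀ {n} → Digraph n → Set
IJDigraph i j {n} D = Acyclic D × (∀ v → indeg D v ≤ i) × (∀ v → outdeg D v ≤ j)

UAdj : ∀ {n} → Digraph n → Fin n → Fin n → Set
UAdj D u v = (D u v ≡ true) ⊎ (D v u ≡ true)

PAdj : ∀ {n} → Digraph n → Fin n → Fin n → Set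
PAdj {n} D u v = u ≢ v × (UAdj D u v ⊎ Σ (Fin n) (λ w → (D u w ≡ true) × (D v w ≡ true)))

CycNext : ∀ {l} → Fin l → Fin l → Set
CycNext {l} a b = (suc (toℕ a) ≡ toℕ b) ⊎ ((suc (toℕ a) ≡ l) × (toℕ b ≡ 0))

CycAdj : ∀ {l} → Fin l → Fin l → Set
CycAdj a b = CycNext a b ⊎ CycNext b a

-- h : Fin l → Fin n lists the vertices v_0 … v_{l-1} of a hole (induced cycle of
-- length l ≥ 4) of the graph with adjacency Adj.
IsHole : ∀ {n} → (Fin n → Fin n → Set) → (l : ℕ) → (Fin l → Fin n) → Set
IsHole Adj l h =
  (4 ≤ l) × (∀ a b → h a ≡ h b → a ≡ b) × (∀ a b → Adj (h a) (h b) ⇔ CycAdj a b)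

HasHoleIn : ∀ {n} → (Fin n → Fin n → Set) → (Fin n → Set) → Set
HasHoleIn {n} Adj S =
  Σ ℕ (λ m → Σ (Fin m → Fin n) (λ g → IsHole Adj m g × (∀ a → S (g a))))

inDegH : ∀ {n l} → Digraph n → (Fin l → Fin n) → Fin l → ℕ
inDegH D h a = count (λ b → D (h b) (h a))

ΓSize : ∀ {n l} → Digraph n → (Fin l → Fin n) → ℕ
ΓSize D h = count (λ a → inDegH D h a ≡ᵇ 2)

-- V(C) = V(H) − Γ_H
InC : ∀ {n l} → Digraph n → (Fin l → Fin n) → Fin n → Set
InC {l = l} D h v = Σ (Fin l) (λ a → (h a ≡ v) × (inDegH D h a ≢ 2))

{-# OPTIONS --safe #-}
-- Read the hole periodically, v t = v_(t mod l), and let C consist of the positions outside Γ_H.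
-- Two vertices of C are adjacent in P(D) only if they are consecutive on C or share an out-neighbour
-- off H; by out-degree 2 that out-neighbour is unique for each of them.  Suppose p and e are C-vertices
-- adjacent in P(D), no chord joins p to the C-vertices strictly between them other than its C-successor,
-- and that successor is not adjacent to e.  Then walking from the successor of p towards e, always
-- jumping to the farthest P(D)-neighbour, gives an induced path that p closes into a hole.
-- If l < 3|Γ_H|, counting orientation changes around H finds two sources of D_H two apart; they have no
-- out-neighbours off H, so the walk works around the first one.  If |C| ≥ 2i + 1, then unless the walk
-- already works around some C-vertex there is an off-H vertex w receiving arcs from two C-vertices.  Either
-- the walk works between two consecutive C-vertices pointing to w that are more than two C-steps apart, or
-- taking C-predecessors injects the C-vertices not pointing to w into those that do, so
-- |C| ≤ 2 indeg w ≤ 2i.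
module Submission where

open import Defs
open import Data.Bool using (Bool; true; false; not; _∧_; _∨_; if_then_else_)
import Data.Bool.Properties as B
open import Data.Bool.Properties using (∧-identityʳ; ∧-zeroʳ; T-≡; not-injective)
open import Data.Empty using (⊥; ⊥-elim)
open import Data.Fin as F using (Fin; zero; suc; toℕ)
import Data.Fin.Properties as FP
open import Data.List using (List; []; _∷_; length)
open import Data.Bool.ListAction using (any)
open import Data.List.Membership.Propositional using (_∈_)
open import Data.List.Relation.Unary.Any using (here; there)
open import Data.Nat using (ℕ; zero; suc; _+_; _*_; _∸_; _≤_; _<_; z≤n; s≤s; z<s; _≡ᵇ_)
open import Data.Nat.DivMod
open import Data.Nat.Properties
open import Algebra.Properties.CommutativeSemigroup +-commutativeSemigroup using (x∙yz≈y∙xz; interchange)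
open import Data.Product using (Σ; _×_; _,_; proj₁; proj₂)
open import Data.Sum using (_⊎_; inj₁; inj₂; [_,_]′)
open import Function using (_∘_)
open import Function.Bundles using (mk⇔; Equivalence)
open import Relation.Binary.Definitions using (tri<; tri≈; tri>)
open import Relation.Binary.PropositionalEquality
open import Relation.Nullary using (¬_; Dec; yes; no; contradiction)
open import Relation.Nullary.Decidable using (does; _×-dec_; ¬?)

bit : Bool → ℕ
bit b = if b then 1 else 0

bit≤1 : ∀ b → bit b ≤ 1
bit≤1 true  = s≤s z≤n
bit≤1 false = z≤n

count-cong : ∀ {m} (p q : Fin m → Bool) → (∀ x → p x ≡ q x) → count p ≡ count q
count-cong {zero}  p q eq = refl
count-cong {suc m} p q eq = cong₂ _+_ (cong bit (eq zero)) (count-cong (p ∘ suc) (q ∘ suc) (eq ∘ suc))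

count-false : ∀ m → count {m} (λ _ → false) ≡ 0
count-false zero    = refl
count-false (suc m) = count-false m

count-remove : ∀ {m} (p : Fin m → Bool) (a : Fin m) →
  count p ≡ bit (p a) + count (λ x → p x ∧ not (does (x F.≟ a)))
count-remove {suc m} p zero =
  cong (bit (p zero) +_)
    (cong₂ _+_ (cong bit (sym (∧-zeroʳ (p zero)))) (count-cong (p ∘ suc) _ (λ x → sym (∧-identityʳ (p (suc x))))))
count-remove {suc m} p (suc a) = begin
    bit (p zero) + count (p ∘ suc)
  ≡⟨ cong (bit (p zero) +_) (count-remove (p ∘ suc) a) ⟩
    bit (p zero) + (bit (p (suc a)) + rest)
  ≡⟨ x∙yz≈y∙xz (bit (p zero)) _ rest ⟩
    bit (p (suc a)) + (bit (p zero) + rest)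
  ≡⟨ cong (λ b → bit (p (suc a)) + (bit b + rest)) (sym (∧-identityʳ (p zero))) ⟩
    bit (p (suc a)) + (bit (p zero ∧ true) + rest)
  ∎
  where
  open ≡-Reasoning
  rest = count (λ x → p (suc x) ∧ not (does (x F.≟ a)))

count-injection : ∀ {a b} (P : Fin a → Bool) (Q : Fin b → Bool) (f : Fin a → Fin b) →
  (∀ x → P x ≡ true → Q (f x) ≡ true) →
  (∀ x y → P x ≡ true → P y ≡ true → f x ≡ f y → x ≡ y) →
  count P ≤ count Q
count-injection {zero}  P Q f P⇒Qf f-inj = z≤n
count-injection {suc a} P Q f P⇒Qf f-inj with P zero in P0
... | false = count-injection (P ∘ suc) Q (f ∘ suc) (P⇒Qf ∘ suc)
                (λ x y Px Py fx≡fy → FP.suc-injective (f-inj (suc x) (suc y) Px Py fx≡fy))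
... | true = begin
    suc (count (P ∘ suc))
  ≤⟨ s≤s (count-injection (P ∘ suc) Q-f0 (f ∘ suc) P⇒Q-f0
            (λ x y Px Py fx≡fy → FP.suc-injective (f-inj (suc x) (suc y) Px Py fx≡fy))) ⟩
    suc (count Q-f0)
  ≡⟨ cong (λ b → bit b + count Q-f0) (sym (P⇒Qf zero P0)) ⟩
    bit (Q (f zero)) + count Q-f0
  ≡⟨ count-remove Q (f zero) ⟨
    count Q ∎
  where
  open ≤-Reasoning
  Q-f0 = λ y → Q y ∧ not (does (y F.≟ f zero))
  P⇒Q-f0 : ∀ x → P (suc x) ≡ true → Q-f0 (f (suc x)) ≡ true
  P⇒Q-f0 x Px with f (suc x) F.≟ f zero
  ... | yes fx≡f0 = contradiction (f-inj zero (suc x) P0 Px (sym fx≡f0)) λ ()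
  ... | no _ rewrite P⇒Qf (suc x) Px = refl

three≤count : ∀ {m} (p : Fin m → Bool) (a b c : Fin m) → a ≢ b → a ≢ c → b ≢ c →
  p a ≡ true → p b ≡ true → p c ≡ true → 3 ≤ count p
three≤count p a b c a≢b a≢c b≢c pa pb pc =
  count-injection (λ _ → true) p abc (λ { zero _ → pa ; (suc zero) _ → pb ; (suc (suc zero)) _ → pc }) abc-inj
  where
  abc : Fin 3 → _
  abc zero = a
  abc (suc zero) = b
  abc (suc (suc zero)) = c
  abc-inj : ∀ x y → true ≡ true → true ≡ true → abc x ≡ abc y → x ≡ y
  abc-inj zero             zero             _ _ _ = refl
  abc-inj zero             (suc zero)       _ _ e = contradiction e a≢b
  abc-inj zero             (suc (suc zero)) _ _ e = contradiction e a≢c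
  abc-inj (suc zero)       zero             _ _ e = contradiction (sym e) a≢b
  abc-inj (suc zero)       (suc zero)       _ _ _ = refl
  abc-inj (suc zero)       (suc (suc zero)) _ _ e = contradiction e b≢c
  abc-inj (suc (suc zero)) zero             _ _ e = contradiction (sym e) a≢c
  abc-inj (suc (suc zero)) (suc zero)       _ _ e = contradiction (sym e) b≢c
  abc-inj (suc (suc zero)) (suc (suc zero)) _ _ _ = refl

count-supportedOnPair : ∀ {m} (p : Fin m → Bool) (a b : Fin m) → a ≢ b →
  (∀ x → p x ≡ true → x ≡ a ⊎ x ≡ b) → count p ≡ bit (p a) + bit (p b)
count-supportedOnPair {m} p a b a≢b supp = begin
    count p
  ≡⟨ count-remove p a ⟩
    bit (p a) + count p-a
  ≡⟨ cong (bit (p a) +_) (count-remove p-a b) ⟩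
    bit (p a) + (bit (p-a b) + count p-a-b)
  ≡⟨ cong₂ (λ u v → bit (p a) + (bit u + v)) p-a-b≡p-b (trans (count-cong p-a-b _ p-a-b≡false) (count-false m)) ⟩
    bit (p a) + (bit (p b) + 0)
  ≡⟨ cong (bit (p a) +_) (+-identityʳ (bit (p b))) ⟩
    bit (p a) + bit (p b) ∎
  where
  open ≡-Reasoning
  p-a = λ x → p x ∧ not (does (x F.≟ a))
  p-a-b = λ x → p-a x ∧ not (does (x F.≟ b))
  p-a-b≡p-b : p-a b ≡ p b
  p-a-b≡p-b with b F.≟ a
  ... | yes b≡a = contradiction (sym b≡a) a≢b
  ... | no _ = ∧-identityʳ (p b)
  p-a-b≡false : ∀ x → p-a-b x ≡ false
  p-a-b≡false x with p x in px | x F.≟ a | x F.≟ b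
  ... | false | _      | _      = refl
  ... | true  | yes _  | _      = refl
  ... | true  | no _   | yes _  = refl
  ... | true  | no x≢a | no x≢b = ⊥-elim ([ x≢a , x≢b ]′ (supp x px))

bit+bit≡ᵇ2 : ∀ a b → (bit a + bit b ≡ᵇ 2) ≡ a ∧ b
bit+bit≡ᵇ2 true  true  = refl
bit+bit≡ᵇ2 true  false = refl
bit+bit≡ᵇ2 false true  = refl
bit+bit≡ᵇ2 false false = refl

countBelow : ℕ → (ℕ → Bool) → ℕ
countBelow zero    f = 0
countBelow (suc k) f = bit (f 0) + countBelow k (f ∘ suc)

count≡countBelow : ∀ {m} (p : Fin m → Bool) (f : ℕ → Bool) → (∀ a → f (toℕ a) ≡ p a) → count p ≡ countBelow m f
count≡countBelow {zero}  p f eq = refl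
count≡countBelow {suc m} p f eq = cong₂ _+_ (cong bit (sym (eq zero))) (count≡countBelow (p ∘ suc) (f ∘ suc) (eq ∘ suc))

countBelow-cong : ∀ k {f g : ℕ → Bool} → (∀ t → t < k → f t ≡ g t) → countBelow k f ≡ countBelow k g
countBelow-cong zero    eq = refl
countBelow-cong (suc k) eq = cong₂ _+_ (cong bit (eq 0 z<s)) (countBelow-cong k (λ t t<k → eq (suc t) (s≤s t<k)))

countBelow-mono : ∀ k {f g : ℕ → Bool} → (∀ t → t < k → f t ≡ true → g t ≡ true) → countBelow k f ≤ countBelow k g
countBelow-mono zero    f⇒g = z≤n
countBelow-mono (suc k) {f} f⇒g with f 0 in f0
... | true  rewrite f⇒g 0 z<s f0 = s≤s (countBelow-mono k (λ t t<k → f⇒g (suc t) (s≤s t<k)))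
... | false = +-mono-≤ z≤n (countBelow-mono k (λ t t<k → f⇒g (suc t) (s≤s t<k)))

countBelow-additive : ∀ k (f₁ f₂ g₁ g₂ : ℕ → Bool) →
  (∀ t → t < k → bit (f₁ t) + bit (f₂ t) ≡ bit (g₁ t) + bit (g₂ t)) →
  countBelow k f₁ + countBelow k f₂ ≡ countBelow k g₁ + countBelow k g₂
countBelow-additive zero    f₁ f₂ g₁ g₂ eq = refl
countBelow-additive (suc k) f₁ f₂ g₁ g₂ eq = begin
    (bit (f₁ 0) + countBelow k (f₁ ∘ suc)) + (bit (f₂ 0) + countBelow k (f₂ ∘ suc))
  ≡⟨ interchange (bit (f₁ 0)) _ _ _ ⟩
    (bit (f₁ 0) + bit (f₂ 0)) + (countBelow k (f₁ ∘ suc) + countBelow k (f₂ ∘ suc))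
  ≡⟨ cong₂ _+_ (eq 0 z<s) (countBelow-additive k _ _ _ _ (λ t t<k → eq (suc t) (s≤s t<k))) ⟩
    (bit (g₁ 0) + bit (g₂ 0)) + (countBelow k (g₁ ∘ suc) + countBelow k (g₂ ∘ suc))
  ≡⟨ interchange (bit (g₁ 0)) _ _ _ ⟨
    (bit (g₁ 0) + countBelow k (g₁ ∘ suc)) + (bit (g₂ 0) + countBelow k (g₂ ∘ suc)) ∎
  where open ≡-Reasoning

countBelow-true : ∀ k → countBelow k (λ _ → true) ≡ k
countBelow-true zero    = refl
countBelow-true (suc k) = cong suc (countBelow-true k)

countBelow-false : ∀ k → countBelow k (λ _ → false) ≡ 0
countBelow-false zero    = refl
countBelow-false (suc k) = countBelow-false k

countBelow-∨ : ∀ k f g → countBelow k (λ t → f t ∨ g t) ≤ countBelow k f + countBelow k g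
countBelow-∨ k f g = begin
    countBelow k (λ t → f t ∨ g t)
  ≤⟨ m≤m+n _ _ ⟩
    countBelow k (λ t → f t ∨ g t) + countBelow k (λ t → f t ∧ g t)
  ≡⟨ countBelow-additive k _ _ f g (λ t _ → bit-∨-∧ (f t) (g t)) ⟩
    countBelow k f + countBelow k g ∎
  where
  open ≤-Reasoning
  bit-∨-∧ : ∀ a b → bit (a ∨ b) + bit (a ∧ b) ≡ bit a + bit b
  bit-∨-∧ true  true  = refl
  bit-∨-∧ true  false = refl
  bit-∨-∧ false true  = refl
  bit-∨-∧ false false = refl

countBelow-disjoint : ∀ k f g → (∀ t → t < k → f t ∧ g t ≡ false) →
  countBelow k f + countBelow k g ≡ countBelow k (λ t → f t ∨ g t)
countBelow-disjoint k f g disjoint = begin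
    countBelow k f + countBelow k g
  ≡⟨ countBelow-additive k f g (λ t → f t ∨ g t) (λ _ → false) (λ t t<k → bit-disjoint (f t) (g t) (disjoint t t<k)) ⟩
    countBelow k (λ t → f t ∨ g t) + countBelow k (λ _ → false)
  ≡⟨ cong (countBelow k (λ t → f t ∨ g t) +_) (countBelow-false k) ⟩
    countBelow k (λ t → f t ∨ g t) + 0
  ≡⟨ +-identityʳ _ ⟩
    countBelow k (λ t → f t ∨ g t) ∎
  where
  open ≡-Reasoning
  bit-disjoint : ∀ a b → a ∧ b ≡ false → bit a + bit b ≡ bit (a ∨ b) + 0
  bit-disjoint true  false _ = refl
  bit-disjoint false true  _ = refl
  bit-disjoint false false _ = refl

countBelow-complement : ∀ k f → countBelow k f + countBelow k (not ∘ f) ≡ k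
countBelow-complement k f = begin
    countBelow k f + countBelow k (not ∘ f)
  ≡⟨ countBelow-disjoint k f (not ∘ f) (λ t _ → B.∧-inverseʳ (f t)) ⟩
    countBelow k (λ t → f t ∨ not (f t))
  ≡⟨ countBelow-cong k (λ t _ → B.∨-inverseʳ (f t)) ⟩
    countBelow k (λ _ → true)
  ≡⟨ countBelow-true k ⟩
    k ∎
  where open ≡-Reasoning

countBelow-snoc : ∀ k f → countBelow (suc k) f ≡ countBelow k f + bit (f k)
countBelow-snoc zero    f = +-comm (bit (f 0)) 0
countBelow-snoc (suc k) f = trans (cong (bit (f 0) +_) (countBelow-snoc k (f ∘ suc))) (sym (+-assoc (bit (f 0)) _ _))

countBelow-rotate : ∀ k f → f k ≡ f 0 → countBelow k (f ∘ suc) ≡ countBelow k f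
countBelow-rotate k f fk≡f0 = +-cancelˡ-≡ (bit (f 0)) _ _ (begin
    countBelow (suc k) f           ≡⟨ countBelow-snoc k f ⟩
    countBelow k f + bit (f k)     ≡⟨ cong (λ b → countBelow k f + bit b) fk≡f0 ⟩
    countBelow k f + bit (f 0)     ≡⟨ +-comm (countBelow k f) _ ⟩
    bit (f 0) + countBelow k f     ∎)
  where open ≡-Reasoning

countBelow-periodic : ∀ k f → (∀ x → f (k + x) ≡ f x) → ∀ a → countBelow k (λ j → f (a + j)) ≡ countBelow k f
countBelow-periodic k f periodic zero    = refl
countBelow-periodic k f periodic (suc a) = begin
    countBelow k (λ j → f (suc a + j))
  ≡⟨ countBelow-cong k (λ j _ → cong f (sym (+-suc a j))) ⟩
    countBelow k (λ j → f (a + suc j))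
  ≡⟨ countBelow-rotate k (λ j → f (a + j)) fa+k≡fa+0 ⟩
    countBelow k (λ j → f (a + j))
  ≡⟨ countBelow-periodic k f periodic a ⟩
    countBelow k f ∎
  where
  open ≡-Reasoning
  fa+k≡fa+0 : f (a + k) ≡ f (a + 0)
  fa+k≡fa+0 = trans (cong f (+-comm a k)) (trans (periodic a) (cong f (sym (+-identityʳ a))))

countBelow-positive : ∀ k f → 0 < countBelow k f → Σ ℕ λ t → t < k × f t ≡ true
countBelow-positive (suc k) f pos with f 0 in f0
... | true  = 0 , z<s , f0
... | false with countBelow-positive k (f ∘ suc) pos
...   | t , t<k , ft = suc t , s≤s t<k , ft

≡ᵇ-true : ∀ {m n} → (m ≡ᵇ n) ≡ true → m ≡ n
≡ᵇ-true {m} {n} e = ≡ᵇ⇒≡ m n (Equivalence.from T-≡ e)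

≡ᵇ-false : ∀ {m n} → m ≢ n → (m ≡ᵇ n) ≡ false
≡ᵇ-false {m} {n} m≢n with m ≡ᵇ n in e
... | false = refl
... | true  = contradiction (≡ᵇ-true e) m≢n

≡ᵇ-refl : ∀ m → (m ≡ᵇ m) ≡ true
≡ᵇ-refl m = Equivalence.to T-≡ (≡⇒≡ᵇ m m refl)

countBelow-≡ᵇ≤1 : ∀ k a c → countBelow k (λ j → (a + j) ≡ᵇ c) ≤ 1
countBelow-≡ᵇ≤1 zero    a c = z≤n
countBelow-≡ᵇ≤1 (suc k) a c with a + 0 ≟ c
... | yes a+0≡c = +-mono-≤ (bit≤1 _)
    (≤-reflexive (trans (countBelow-cong k (λ j _ → ≡ᵇ-false (a+suc≢c j))) (countBelow-false k)))
  where
  a+suc≢c : ∀ j → a + suc j ≢ c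
  a+suc≢c j eq = contradiction (+-cancelˡ-≡ a (suc j) 0 (trans eq (sym a+0≡c))) λ ()
... | no a+0≢c = begin
    bit (a + 0 ≡ᵇ c) + countBelow k (λ j → a + suc j ≡ᵇ c)
  ≡⟨ cong₂ _+_ (cong bit (≡ᵇ-false a+0≢c)) (countBelow-cong k (λ j _ → cong (_≡ᵇ c) (+-suc a j))) ⟩
    countBelow k (λ j → suc a + j ≡ᵇ c)
  ≤⟨ countBelow-≡ᵇ≤1 k (suc a) c ⟩
    1 ∎
  where open ≤-Reasoning

∈⇒any≡ᵇ : ∀ t xs → t ∈ xs → any (t ≡ᵇ_) xs ≡ true
∈⇒any≡ᵇ t (x ∷ xs) (here refl) rewrite ≡ᵇ-refl t = refl
∈⇒any≡ᵇ t (x ∷ xs) (there t∈xs) = trans (cong ((t ≡ᵇ x) ∨_) (∈⇒any≡ᵇ t xs t∈xs)) (B.∨-zeroʳ _)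

countBelow-any≤length : ∀ k a (xs : List ℕ) → countBelow k (λ j → any (a + j ≡ᵇ_) xs) ≤ length xs
countBelow-any≤length k a []       = ≤-reflexive (countBelow-false k)
countBelow-any≤length k a (x ∷ xs) = begin
    countBelow k (λ j → (a + j ≡ᵇ x) ∨ any (a + j ≡ᵇ_) xs)
  ≤⟨ countBelow-∨ k _ _ ⟩
    countBelow k (λ j → a + j ≡ᵇ x) + countBelow k (λ j → any (a + j ≡ᵇ_) xs)
  ≤⟨ +-mono-≤ (countBelow-≡ᵇ≤1 k a x) (countBelow-any≤length k a xs) ⟩
    suc (length xs) ∎
  where open ≤-Reasoning

data MinimalBelow (P : ℕ → Set) (N : ℕ) : Set where
  found : ∀ j → j < N → P j → (∀ k → k < j → ¬ P k) → MinimalBelow P N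
  none  : (∀ k → k < N → ¬ P k) → MinimalBelow P N

minimalBelow : (P : ℕ → Set) → (∀ j → Dec (P j)) → ∀ N → MinimalBelow P N
minimalBelow P P? zero = none (λ k ())
minimalBelow P P? (suc N) with minimalBelow P P? N
... | found j j<N Pj below = found j (m<n⇒m<1+n j<N) Pj below
... | none ¬P<N with P? N
...   | yes PN = found N ≤-refl PN ¬P<N
...   | no ¬PN = none ¬P<1+N
  where
  ¬P<1+N : ∀ k → k < suc N → ¬ P k
  ¬P<1+N k (s≤s k≤N) with m≤n⇒m<n∨m≡n k≤N
  ... | inj₁ k<N  = ¬P<N k k<N
  ... | inj₂ refl = ¬PN

CyclicallyConsecutive : ℕ → ℕ → ℕ → Set
CyclicallyConsecutive M j k = (k ≡ suc j) ⊎ (j ≡ 0 × suc k ≡ M)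

module _ {n : ℕ} (Adj : Fin n → Fin n → Set)
  (Adj-sym : ∀ u v → Adj u v → Adj v u) (Adj-irrefl : ∀ u → ¬ Adj u u) where

  isHole-fromSequence : (M : ℕ) → 4 ≤ M → (G : ℕ → Fin n) →
    (∀ j k → j < k → k < M → G j ≢ G k) →
    (∀ j k → j < k → k < M → Adj (G j) (G k) → CyclicallyConsecutive M j k) →
    (∀ j k → j < k → k < M → CyclicallyConsecutive M j k → Adj (G j) (G k)) →
    IsHole Adj M (G ∘ toℕ)
  isHole-fromSequence M 4≤M G G-inj only-consecutive consecutive =
    4≤M , injective , λ a b → mk⇔ (adj⇒cycAdj a b) (cycAdj⇒adj a b)
    where
    injective : ∀ a b → G (toℕ a) ≡ G (toℕ b) → a ≡ b
    injective a b eq with <-cmp (toℕ a) (toℕ b)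
    ... | tri< a<b _ _ = contradiction eq (G-inj _ _ a<b (FP.toℕ<n b))
    ... | tri≈ _ a≡b _ = FP.toℕ-injective a≡b
    ... | tri> _ _ b<a = contradiction (sym eq) (G-inj _ _ b<a (FP.toℕ<n a))
    adj⇒cycAdj : ∀ a b → Adj (G (toℕ a)) (G (toℕ b)) → CycAdj a b
    adj⇒cycAdj a b adj with <-cmp (toℕ a) (toℕ b)
    ... | tri≈ _ a≡b _ rewrite FP.toℕ-injective a≡b = contradiction adj (Adj-irrefl _)
    ... | tri< a<b _ _ with only-consecutive _ _ a<b (FP.toℕ<n b) adj
    ...   | inj₁ b≡1+a         = inj₁ (inj₁ (sym b≡1+a))
    ...   | inj₂ (a≡0 , 1+b≡M) = inj₂ (inj₂ (1+b≡M , a≡0))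
    adj⇒cycAdj a b adj | tri> _ _ b<a with only-consecutive _ _ b<a (FP.toℕ<n a) (Adj-sym _ _ adj)
    ...   | inj₁ a≡1+b         = inj₂ (inj₁ (sym a≡1+b))
    ...   | inj₂ (b≡0 , 1+a≡M) = inj₁ (inj₂ (1+a≡M , b≡0))
    0<pred-M : ∀ {x} → suc x ≡ M → 0 < x
    0<pred-M {zero}  refl = contradiction 4≤M λ { (s≤s ()) }
    0<pred-M {suc x} _ = z<s
    cycAdj⇒adj : ∀ a b → CycAdj a b → Adj (G (toℕ a)) (G (toℕ b))
    cycAdj⇒adj a b (inj₁ (inj₁ 1+a≡b)) =
      consecutive _ _ (≤-reflexive 1+a≡b) (FP.toℕ<n b) (inj₁ (sym 1+a≡b))
    cycAdj⇒adj a b (inj₁ (inj₂ (1+a≡M , b≡0))) rewrite b≡0 =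
      Adj-sym _ _ (consecutive 0 (toℕ a) (0<pred-M 1+a≡M) (FP.toℕ<n a) (inj₂ (refl , 1+a≡M)))
    cycAdj⇒adj a b (inj₂ (inj₁ 1+b≡a)) =
      Adj-sym _ _ (consecutive _ _ (≤-reflexive 1+b≡a) (FP.toℕ<n a) (inj₁ (sym 1+b≡a)))
    cycAdj⇒adj a b (inj₂ (inj₂ (1+b≡M , a≡0))) rewrite a≡0 =
      consecutive 0 (toℕ b) (0<pred-M 1+b≡M) (FP.toℕ<n b) (inj₂ (refl , 1+b≡M))

module Cyclic (L : ℕ) where

  l : ℕ
  l = suc L

  infix 4 _≡ₘ_
  record _≡ₘ_ (x y : ℕ) : Set where
    constructor mod-eq
    field mod-≡ : x % l ≡ y % l
  open _≡ₘ_ public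

  ≡ₘ-refl : ∀ {x} → x ≡ₘ x
  ≡ₘ-refl = mod-eq refl

  ≡ₘ-sym : ∀ {x y} → x ≡ₘ y → y ≡ₘ x
  ≡ₘ-sym (mod-eq e) = mod-eq (sym e)

  ≡ₘ-trans : ∀ {x y z} → x ≡ₘ y → y ≡ₘ z → x ≡ₘ z
  ≡ₘ-trans (mod-eq e) (mod-eq f) = mod-eq (trans e f)

  ≡⇒≡ₘ : ∀ {x y} → x ≡ y → x ≡ₘ y
  ≡⇒≡ₘ refl = ≡ₘ-refl

  %≡ₘ : ∀ x → x % l ≡ₘ x
  %≡ₘ x = mod-eq (m%n%n≡m%n x l)

  +l≡ₘ : ∀ x → x + l ≡ₘ x
  +l≡ₘ x = mod-eq ([m+n]%n≡m%n x l)

  ≡ₘ-+ : ∀ {x y} c → x ≡ₘ y → x + c ≡ₘ y + c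
  ≡ₘ-+ {x} {y} c (mod-eq e) = mod-eq (begin
    (x + c) % l                  ≡⟨ %-distribˡ-+ x c l ⟩
    ((x % l) + (c % l)) % l      ≡⟨ cong (λ z → (z + c % l) % l) e ⟩
    ((y % l) + (c % l)) % l      ≡⟨ %-distribˡ-+ y c l ⟨
    (y + c) % l                  ∎)
    where open ≡-Reasoning

  ≡ₘ-suc : ∀ {x y} → x ≡ₘ y → suc x ≡ₘ suc y
  ≡ₘ-suc {x} {y} e = ≡ₘ-trans (≡⇒≡ₘ (+-comm 1 x)) (≡ₘ-trans (≡ₘ-+ 1 e) (≡⇒≡ₘ (+-comm y 1)))

  suc[+L]≡ₘ : ∀ x → suc (x + L) ≡ₘ x
  suc[+L]≡ₘ x = ≡ₘ-trans (≡⇒≡ₘ (sym (+-suc x L))) (+l≡ₘ x)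

  ≡ₘ-suc⁻¹ : ∀ {x y} → suc x ≡ₘ suc y → x ≡ₘ y
  ≡ₘ-suc⁻¹ {x} {y} e = ≡ₘ-trans (≡ₘ-sym (suc[+L]≡ₘ x)) (≡ₘ-trans (≡ₘ-+ L e) (suc[+L]≡ₘ y))

  ≡ₘ-window : ∀ s t → s ≤ t → t < s + l → s ≡ₘ t → s ≡ t
  ≡ₘ-window zero    t       z≤n       t<l          (mod-eq e) = trans e (m<n⇒m%n≡m t<l)
  ≡ₘ-window (suc s) (suc t) (s≤s s≤t) (s≤s t<s+l) e = cong suc (≡ₘ-window s t s≤t t<s+l (≡ₘ-suc⁻¹ e))

  ≡ₘ-below-l : ∀ {t t'} → t < l → t' < l → t ≡ₘ t' → t ≡ t'
  ≡ₘ-below-l {t} {t'} t<l t'<l (mod-eq e) = trans (sym (m<n⇒m%n≡m t<l)) (trans e (m<n⇒m%n≡m t'<l))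

  representativeAfter : ∀ x y → Σ ℕ λ u → x < u × u ≤ x + l × u ≡ₘ y
  representativeAfter zero y with y % l in y%l
  ... | zero  = l , z<s , ≤-refl , mod-eq (trans (n%n≡0 l) (sym y%l))
  ... | suc r = suc r , z<s , subst (_≤ l) y%l (m%n≤n y l) , ≡ₘ-trans (≡⇒≡ₘ (sym y%l)) (%≡ₘ y)
  representativeAfter (suc x) y with representativeAfter x y
  ... | u , x<u , u≤x+l , u≡y with m≤n⇒m<n∨m≡n x<u
  ...   | inj₁ 1+x<u = u , 1+x<u , m≤n⇒m≤1+n u≤x+l , u≡y
  ...   | inj₂ refl  = suc x + l , m<m+n (suc x) z<s , ≤-refl , ≡ₘ-trans (+l≡ₘ (suc x)) u≡y

  offset<l : ∀ x {c} → c < l → c + x < x + l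
  offset<l x {c} c<l = subst (_< x + l) (+-comm x c) (+-monoʳ-< x c<l)

  idx : ℕ → Fin l
  idx t = F.fromℕ< (m%n<n t l)

  toℕ-idx : ∀ t → toℕ (idx t) ≡ t % l
  toℕ-idx t = FP.toℕ-fromℕ< (m%n<n t l)

  idx-cong : ∀ {x y} → x ≡ₘ y → idx x ≡ idx y
  idx-cong {x} {y} (mod-eq e) = FP.toℕ-injective (trans (toℕ-idx x) (trans e (sym (toℕ-idx y))))

  idx-injective : ∀ {x y} → idx x ≡ idx y → x ≡ₘ y
  idx-injective {x} {y} e = mod-eq (trans (sym (toℕ-idx x)) (trans (cong toℕ e) (toℕ-idx y)))

  idx-toℕ : ∀ (a : Fin l) → idx (toℕ a) ≡ a
  idx-toℕ a = FP.toℕ-injective (trans (toℕ-idx (toℕ a)) (m<n⇒m%n≡m (FP.toℕ<n a)))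

  cycNext-idx : ∀ x → CycNext (idx x) (idx (suc x))
  cycNext-idx x rewrite toℕ-idx x | toℕ-idx (suc x) | mod-≡ (≡ₘ-suc (≡ₘ-sym (%≡ₘ x))) with suc (x % l) <? l
  ... | yes 1+x%l<l = inj₁ (sym (m<n⇒m%n≡m 1+x%l<l))
  ... | no 1+x%l≮l = inj₂ (1+x%l≡l , trans (cong (_% l) 1+x%l≡l) (n%n≡0 l))
    where
    1+x%l≡l : suc (x % l) ≡ l
    1+x%l≡l = ≤-antisym (m%n<n x l) (≮⇒≥ 1+x%l≮l)

  cycNext-idx⁻¹ : ∀ a b → CycNext (idx a) (idx b) → suc a ≡ₘ b
  cycNext-idx⁻¹ a b next = ≡ₘ-trans (≡ₘ-suc (≡ₘ-sym (%≡ₘ a))) (step next)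
    where
    step : CycNext (idx a) (idx b) → suc (a % l) ≡ₘ b
    step (inj₁ 1+a′≡b′) =
      ≡ₘ-trans (≡⇒≡ₘ (trans (cong suc (sym (toℕ-idx a))) (trans 1+a′≡b′ (toℕ-idx b)))) (%≡ₘ b)
    step (inj₂ (1+a′≡l , b′≡0)) = mod-eq (begin
      suc (a % l) % l       ≡⟨ cong (λ z → suc z % l) (toℕ-idx a) ⟨
      suc (toℕ (idx a)) % l ≡⟨ cong (_% l) 1+a′≡l ⟩
      l % l                 ≡⟨ n%n≡0 l ⟩
      0                     ≡⟨ b′≡0 ⟨
      toℕ (idx b)           ≡⟨ toℕ-idx b ⟩
      b % l                 ∎)
      where open ≡-Reasoning

  countBelow-injectionₘ : (P Q : ℕ → Bool) → (∀ {x y} → x ≡ₘ y → Q x ≡ Q y) → (φ : ℕ → ℕ) →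
    (∀ t → t < l → P t ≡ true → Q (φ t) ≡ true) →
    (∀ t t' → t < l → t' < l → P t ≡ true → P t' ≡ true → φ t ≡ₘ φ t' → t ≡ t') →
    countBelow l P ≤ countBelow l Q
  countBelow-injectionₘ P Q Q-cong φ P⇒Qφ φ-inj =
    subst₂ _≤_ (count≡countBelow {l} (P ∘ toℕ) P (λ _ → refl)) (count≡countBelow {l} (Q ∘ toℕ) Q (λ _ → refl))
      (count-injection (P ∘ toℕ) (Q ∘ toℕ) (idx ∘ φ ∘ toℕ) P⇒Qφ′ φ-inj′)
    where
    P⇒Qφ′ : ∀ a → P (toℕ a) ≡ true → Q (toℕ (idx (φ (toℕ a)))) ≡ true
    P⇒Qφ′ a Pa = trans (cong Q (toℕ-idx (φ (toℕ a)))) (trans (Q-cong (%≡ₘ _)) (P⇒Qφ (toℕ a) (FP.toℕ<n a) Pa))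
    φ-inj′ : ∀ a b → P (toℕ a) ≡ true → P (toℕ b) ≡ true → idx (φ (toℕ a)) ≡ idx (φ (toℕ b)) → a ≡ b
    φ-inj′ a b Pa Pb e = FP.toℕ-injective (φ-inj _ _ (FP.toℕ<n a) (FP.toℕ<n b) Pa Pb (idx-injective e))

module _ {n : ℕ} (D : Digraph n) where

  PAdj-sym : ∀ u w → PAdj D u w → PAdj D w u
  PAdj-sym u w (u≢w , inj₁ (inj₁ uw))     = u≢w ∘ sym , inj₁ (inj₂ uw)
  PAdj-sym u w (u≢w , inj₁ (inj₂ wu))     = u≢w ∘ sym , inj₁ (inj₁ wu)
  PAdj-sym u w (u≢w , inj₂ (x , ux , wx)) = u≢w ∘ sym , inj₂ (x , wx , ux)

  PAdj-irrefl : ∀ u → ¬ PAdj D u u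
  PAdj-irrefl u (u≢u , _) = u≢u refl

  PAdj? : ∀ u w → Dec (PAdj D u w)
  PAdj? u w with u F.≟ w
  ... | yes u≡w = no λ adj → proj₁ adj u≡w
  ... | no u≢w with D u w | D w u | FP.any? (λ x → (D u x B.≟ true) ×-dec (D w x B.≟ true))
  ...   | true  | _     | _          = yes (u≢w , inj₁ (inj₁ refl))
  ...   | false | true  | _          = yes (u≢w , inj₁ (inj₂ refl))
  ...   | false | false | yes common = yes (u≢w , inj₂ common)
  ...   | false | false | no ¬common = no λ
    { (_ , inj₁ (inj₁ ())) ; (_ , inj₁ (inj₂ ())) ; (_ , inj₂ common) → ¬common common }

module _ {n : ℕ} {D : Digraph n} (acyclic : Acyclic D) where

  Acyclic⇒loopless : ∀ u → D u u ≢ true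
  Acyclic⇒loopless u uu = acyclic 0 (λ { zero → u ; (suc zero) → u }) (λ { zero → uu }) refl

  Acyclic⇒asymmetric : ∀ u w → D u w ≡ true → D w u ≢ true
  Acyclic⇒asymmetric u w uw wu =
    acyclic 1 (λ { zero → u ; (suc zero) → w ; (suc (suc zero)) → u }) (λ { zero → uw ; (suc zero) → wu }) refl

module HoleSetting {n : ℕ} (D : Digraph n)
  (loopless : ∀ u → D u u ≢ true)
  (asymmetric : ∀ u w → D u w ≡ true → D w u ≢ true)
  (outdeg≤2 : ∀ u → outdeg D u ≤ 2)
  (k : ℕ) (h : Fin (5 + k) → Fin n) (h-hole : IsHole (UAdj D) (5 + k) h) where

  -- Positions are read modulo l = 5 + k, so x + L is the position before x.
  L : ℕ
  L = 4 + k

  open Cyclic L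

  v : ℕ → Fin n
  v t = h (idx t)

  v-cong : ∀ {x y} → x ≡ₘ y → v x ≡ v y
  v-cong e = cong h (idx-cong e)

  v-injective : ∀ {x y} → v x ≡ v y → x ≡ₘ y
  v-injective e = idx-injective (proj₁ (proj₂ h-hole) _ _ e)

  v≢v : ∀ s t → s < t → t < s + l → v s ≢ v t
  v≢v s t s<t t<s+l e = <⇒≢ s<t (≡ₘ-window s t (<⇒≤ s<t) t<s+l (v-injective e))

  v+l : ∀ x → v (x + l) ≡ v x
  v+l x = v-cong (+l≡ₘ x)

  adjacent-suc : ∀ x → UAdj D (v x) (v (suc x))
  adjacent-suc x = Equivalence.from (proj₂ (proj₂ h-hole) _ _) (inj₁ (cycNext-idx x))

  adjacent⇒consecutive : ∀ s t → s < t → t < s + l → UAdj D (v s) (v t) → (t ≡ suc s) ⊎ (suc t ≡ s + l)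
  adjacent⇒consecutive s t s<t t<s+l adj with Equivalence.to (proj₂ (proj₂ h-hole) _ _) adj
  ... | inj₁ next = inj₁ (sym (≡ₘ-window (suc s) t s<t (m<n⇒m<1+n t<s+l) (cycNext-idx⁻¹ s t next)))
  ... | inj₂ prev = inj₂ (≡ₘ-window (suc t) (s + l) t<s+l (m<n⇒m<1+n (+-monoˡ-< l s<t))
                           (≡ₘ-trans (cycNext-idx⁻¹ t s prev) (≡ₘ-sym (+l≡ₘ s))))

  forward : ℕ → Bool
  forward x = D (v x) (v (suc x))

  forward-cong : ∀ {x y} → x ≡ₘ y → forward x ≡ forward y
  forward-cong e = cong₂ D (v-cong e) (v-cong (≡ₘ-suc e))

  backward≡not-forward : ∀ x → D (v (suc x)) (v x) ≡ not (forward x)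
  backward≡not-forward x with forward x in fx | D (v (suc x)) (v x) in bx
  ... | true  | true  = contradiction bx (asymmetric _ _ fx)
  ... | true  | false = refl
  ... | false | true  = refl
  ... | false | false with adjacent-suc x
  ...   | inj₁ fx′ = contradiction (trans (sym fx′) fx) λ ()
  ...   | inj₂ bx′ = contradiction (trans (sym bx′) bx) λ ()

  v-after : ∀ x (b : Fin l) → Σ ℕ λ u → x < u × u ≤ x + l × idx u ≡ b
  v-after x b with representativeAfter x (toℕ b)
  ... | u , x<u , u≤x+l , u≡b = u , x<u , u≤x+l , trans (idx-cong u≡b) (idx-toℕ b)

  inNeighbourOnH : ∀ x (b : Fin l) → D (h b) (v (suc x)) ≡ true → b ≡ idx x ⊎ b ≡ idx (suc (suc x))
  inNeighbourOnH x b arc with v-after x b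
  ... | u , x<u , u≤x+l , idx-u≡b with m≤n⇒m<n∨m≡n x<u
  ...   | inj₂ refl = contradiction arc′ (loopless _)
    where arc′ = subst (λ c → D (h c) (v u) ≡ true) (sym idx-u≡b) arc
  ...   | inj₁ 1+x<u
      with adjacent⇒consecutive (suc x) u 1+x<u (s≤s u≤x+l)
             (inj₂ (subst (λ c → D (h c) (v (suc x)) ≡ true) (sym idx-u≡b) arc))
  ...     | inj₁ refl = inj₂ (sym idx-u≡b)
  ...     | inj₂ 1+u≡1+x+l =
    inj₁ (trans (sym idx-u≡b) (idx-cong (≡ₘ-trans (≡⇒≡ₘ (suc-injective 1+u≡1+x+l)) (+l≡ₘ x))))

  idx≢idx-suc² : ∀ x → idx x ≢ idx (suc (suc x))
  idx≢idx-suc² x e = <⇒≢ x<2+x (≡ₘ-window x (2 + x) (<⇒≤ x<2+x) (offset<l x (s≤s (s≤s z<s))) (idx-injective e))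
    where
    x<2+x : x < 2 + x
    x<2+x = m<n⇒m<1+n ≤-refl

  inDegH-suc : ∀ x → inDegH D h (idx (suc x)) ≡ bit (forward x) + bit (not (forward (suc x)))
  inDegH-suc x = begin
      count (λ b → D (h b) (v (suc x)))
    ≡⟨ count-supportedOnPair _ (idx x) (idx (suc (suc x))) (idx≢idx-suc² x) (inNeighbourOnH x) ⟩
      bit (D (v x) (v (suc x))) + bit (D (v (suc (suc x))) (v (suc x)))
    ≡⟨ cong (λ b → bit (forward x) + bit b) (backward≡not-forward (suc x)) ⟩
      bit (forward x) + bit (not (forward (suc x))) ∎
    where open ≡-Reasoning

  inΓ : ℕ → Bool
  inΓ x = forward (x + L) ∧ not (forward x)

  onC : ℕ → Bool
  onC x = not (inΓ x)

  sizeC : ℕ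
  sizeC = countBelow l onC

  forward-pred : ∀ x → forward (suc (x + L)) ≡ forward x
  forward-pred x = forward-cong (suc[+L]≡ₘ x)

  inΓ-cong : ∀ {x y} → x ≡ₘ y → inΓ x ≡ inΓ y
  inΓ-cong e = cong₂ (λ a b → a ∧ not b) (forward-cong (≡ₘ-+ L e)) (forward-cong e)

  onC-cong : ∀ {x y} → x ≡ₘ y → onC x ≡ onC y
  onC-cong e = cong not (inΓ-cong e)

  inΓ-suc : ∀ x → inΓ (suc x) ≡ forward x ∧ not (forward (suc x))
  inΓ-suc x = cong (λ b → b ∧ not (forward (suc x))) (forward-pred x)

  inDegH≡ᵇ2 : ∀ x → (inDegH D h (idx x) ≡ᵇ 2) ≡ inΓ x
  inDegH≡ᵇ2 x = begin
      inDegH D h (idx x) ≡ᵇ 2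
    ≡⟨ cong (λ a → inDegH D h a ≡ᵇ 2) (idx-cong (≡ₘ-sym (suc[+L]≡ₘ x))) ⟩
      inDegH D h (idx (suc (x + L))) ≡ᵇ 2
    ≡⟨ cong (_≡ᵇ 2) (inDegH-suc (x + L)) ⟩
      bit (forward (x + L)) + bit (not (forward (suc (x + L)))) ≡ᵇ 2
    ≡⟨ cong (λ b → bit (forward (x + L)) + bit (not b) ≡ᵇ 2) (forward-pred x) ⟩
      bit (forward (x + L)) + bit (not (forward x)) ≡ᵇ 2
    ≡⟨ bit+bit≡ᵇ2 (forward (x + L)) _ ⟩
      inΓ x ∎
    where open ≡-Reasoning

  ΓSize≡countBelow : ΓSize D h ≡ countBelow l inΓ
  ΓSize≡countBelow =
    count≡countBelow {l} _ inΓ (λ a → trans (sym (inDegH≡ᵇ2 (toℕ a))) (cong (λ b → inDegH D h b ≡ᵇ 2) (idx-toℕ a)))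

  l∸ΓSize≡sizeC : l ∸ ΓSize D h ≡ sizeC
  l∸ΓSize≡sizeC = begin
    l ∸ ΓSize D h                                          ≡⟨ cong (l ∸_) ΓSize≡countBelow ⟩
    l ∸ countBelow l inΓ                                   ≡⟨ cong (_∸ countBelow l inΓ) (countBelow-complement l inΓ) ⟨
    countBelow l inΓ + countBelow l onC ∸ countBelow l inΓ  ≡⟨ m+n∸m≡n (countBelow l inΓ) _ ⟩
    countBelow l onC                                       ∎
    where open ≡-Reasoning

  inΓ-suc⇒forward : ∀ x → inΓ (suc x) ≡ true → forward x ≡ true × forward (suc x) ≡ false
  inΓ-suc⇒forward x γ with forward x | forward (suc x) | inΓ-suc x
  ... | true | false | _ = refl , refl
  ... | true | true  | e = contradiction (trans (sym γ) e) λ ()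
  ... | false | _    | e = contradiction (trans (sym γ) e) λ ()

  inΓ-notBefore : ∀ x → inΓ (suc x) ≡ true → inΓ x ≡ false
  inΓ-notBefore x γ rewrite proj₁ (inΓ-suc⇒forward x γ) = ∧-zeroʳ (forward (x + L))

  inΓ-notAfter : ∀ x → inΓ (suc x) ≡ true → inΓ (suc (suc x)) ≡ false
  inΓ-notAfter x γ rewrite inΓ-suc (suc x) | proj₂ (inΓ-suc⇒forward x γ) = refl

  nextC : ℕ → ℕ
  nextC x = if inΓ (suc x) then suc (suc x) else suc x

  data NextCView (x : ℕ) : Set where
    skip : inΓ (suc x) ≡ true  → nextC x ≡ suc (suc x) → NextCView x
    step : inΓ (suc x) ≡ false → nextC x ≡ suc x       → NextCView x

  nextC-view : ∀ x → NextCView x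
  nextC-view x with inΓ (suc x) in γ
  ... | true  = skip γ (cong (λ b → if b then suc (suc x) else suc x) γ)
  ... | false = step γ (cong (λ b → if b then suc (suc x) else suc x) γ)

  nextC-skip : ∀ x → inΓ (suc x) ≡ true → nextC x ≡ suc (suc x)
  nextC-skip x γ with nextC-view x
  ... | skip _ e  = e
  ... | step γ′ _ = contradiction (trans (sym γ) γ′) λ ()

  nextC-step : ∀ x → inΓ (suc x) ≡ false → nextC x ≡ suc x
  nextC-step x γ with nextC-view x
  ... | step _ e  = e
  ... | skip γ′ _ = contradiction (trans (sym γ′) γ) λ ()

  nextC-onC : ∀ x → inΓ (nextC x) ≡ false
  nextC-onC x with nextC-view x
  ... | skip γ e rewrite e = inΓ-notAfter x γ
  ... | step γ e rewrite e = γ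

  x<nextC : ∀ x → x < nextC x
  x<nextC x with nextC-view x
  ... | skip _ e rewrite e = m<n⇒m<1+n ≤-refl
  ... | step _ e rewrite e = ≤-refl

  nextC≤2+x : ∀ x → nextC x ≤ suc (suc x)
  nextC≤2+x x with nextC-view x
  ... | skip _ e rewrite e = ≤-refl
  ... | step _ e rewrite e = n≤1+n _

  nextC-nothingBetween : ∀ x b → x < b → b < nextC x → inΓ b ≢ false
  nextC-nothingBetween x b x<b b<next γ with nextC-view x
  ... | step _ e rewrite e = <⇒≱ b<next x<b
  ... | skip γ′ e rewrite e with m≤n⇒m<n∨m≡n x<b
  ...   | inj₂ refl = contradiction (trans (sym γ′) γ) λ ()
  ...   | inj₁ 1+x<b = <⇒≱ b<next 1+x<b

  nextC-minimal : ∀ x b → x < b → inΓ b ≡ false → nextC x ≤ b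
  nextC-minimal x b x<b γ = ≮⇒≥ (λ b<next → nextC-nothingBetween x b x<b b<next γ)

  nextC-mono : ∀ a b → a ≤ b → nextC a ≤ nextC b
  nextC-mono a b a≤b = nextC-minimal a (nextC b) (≤-<-trans a≤b (x<nextC b)) (nextC-onC b)

  nextC-cong : ∀ {x y} → x ≡ₘ y → nextC x ≡ₘ nextC y
  nextC-cong {x} {y} e with nextC-view x | nextC-view y
  ... | skip _ e₁  | skip _ e₂ rewrite e₁ | e₂ = ≡ₘ-suc (≡ₘ-suc e)
  ... | step _ e₁  | step _ e₂ rewrite e₁ | e₂ = ≡ₘ-suc e
  ... | skip γ₁ _  | step γ₂ _ = contradiction (trans (sym γ₁) (trans (inΓ-cong (≡ₘ-suc e)) γ₂)) λ ()
  ... | step γ₁ _  | skip γ₂ _ = contradiction (trans (sym γ₂) (trans (inΓ-cong (≡ₘ-suc (≡ₘ-sym e))) γ₁)) λ ()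

  prevC : ℕ → ℕ
  prevC x = if inΓ (x + L) then x + (3 + k) else x + L

  data PrevCView (x : ℕ) : Set where
    skip : inΓ (x + L) ≡ true  → prevC x ≡ x + (3 + k) → PrevCView x
    step : inΓ (x + L) ≡ false → prevC x ≡ x + L       → PrevCView x

  prevC-view : ∀ x → PrevCView x
  prevC-view x with inΓ (x + L) in γ
  ... | true  = skip γ (cong (λ b → if b then x + (3 + k) else x + L) γ)
  ... | false = step γ (cong (λ b → if b then x + (3 + k) else x + L) γ)

  suc[+3+k] : ∀ x → suc (x + (3 + k)) ≡ x + L
  suc[+3+k] x = sym (+-suc x (3 + k))

  suc[+L] : ∀ x → suc (x + L) ≡ x + l
  suc[+L] x = sym (+-suc x L)

  prevC-onC : ∀ x → inΓ (prevC x) ≡ false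
  prevC-onC x with prevC-view x
  ... | step γ e rewrite e = γ
  ... | skip γ e rewrite e = inΓ-notBefore (x + (3 + k)) (subst (λ z → inΓ z ≡ true) (sym (suc[+3+k] x)) γ)

  nextC-prevC : ∀ x → inΓ x ≡ false → nextC (prevC x) ≡ x + l
  nextC-prevC x γ with prevC-view x
  ... | step γ′ e rewrite e with nextC-view (x + L)
  ...   | step _ e′ = trans e′ (suc[+L] x)
  ...   | skip γ″ _ = contradiction (trans (sym γ″) (trans (inΓ-cong (suc[+L]≡ₘ x)) γ)) λ ()
  nextC-prevC x γ | skip γ′ e rewrite e with nextC-view (x + (3 + k))
  ...   | skip _ e′ = trans e′ (trans (cong suc (suc[+3+k] x)) (suc[+L] x))
  ...   | step γ″ _ = contradiction (trans (sym γ′) (trans (cong inΓ (sym (suc[+3+k] x))) γ″)) λ ()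

  3+x≤prevC : ∀ x → x + 3 ≤ prevC x
  3+x≤prevC x with prevC-view x
  ... | skip _ e rewrite e = +-monoʳ-≤ x (m≤m+n 3 k)
  ... | step _ e rewrite e = +-monoʳ-≤ x (m≤n⇒m≤1+n (m≤m+n 3 k))

  prevC<x+l : ∀ x → prevC x < x + l
  prevC<x+l x with prevC-view x
  ... | skip _ e rewrite e = +-monoʳ-< x (n≤1+n L)
  ... | step _ e rewrite e = +-monoʳ-< x ≤-refl

  nextC<prevC : ∀ x → nextC x < prevC x
  nextC<prevC x = <-≤-trans (s≤s (nextC≤2+x x)) (subst (_≤ prevC x) (+-comm x 3) (3+x≤prevC x))

  1<l : 1 < l
  1<l = s≤s (s≤s z≤n)

  2<l : 2 < l
  2<l = s≤s (s≤s (s≤s z≤n))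

  PAdj-nextC : ∀ x → inΓ x ≡ false → PAdj D (v x) (v (nextC x))
  PAdj-nextC x γ with nextC-view x
  ... | step _ e rewrite e = v≢v x (suc x) ≤-refl (offset<l x 1<l) , inj₁ (adjacent-suc x)
  ... | skip γ′ e rewrite e with inΓ-suc⇒forward x γ′
  ...   | fx , ¬f1+x = v≢v x (suc (suc x)) (m<n⇒m<1+n ≤-refl) (offset<l x 2<l) ,
                       inj₂ (v (suc x) , fx , trans (backward≡not-forward (suc x)) (cong not ¬f1+x))

  OffH : Fin n → Set
  OffH w = ∀ c → h c ≢ w

  noThreeOutNeighbours : ∀ u a b c → a ≢ b → a ≢ c → b ≢ c →
    D u a ≡ true → D u b ≡ true → D u c ≡ true → ⊥
  noThreeOutNeighbours u a b c a≢b a≢c b≢c ua ub uc =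
    <⇒≱ (three≤count (D u) a b c a≢b a≢c b≢c ua ub uc) (outdeg≤2 u)

  arc-to-pred : ∀ x → forward (x + L) ≡ false → D (v x) (v (x + L)) ≡ true
  arc-to-pred x f = subst (λ u → D u (v (x + L)) ≡ true) (v-cong (suc[+L]≡ₘ x))
                      (trans (backward≡not-forward (x + L)) (cong not f))

  outNeighbourOnH : ∀ x → inΓ x ≡ false → Σ ℕ λ z → D (v x) (v z) ≡ true
  outNeighbourOnH x γ with forward x in fx
  ... | true  = suc x , fx
  ... | false = x + L , arc-to-pred x (trans (sym (∧-identityʳ (forward (x + L)))) γ)

  offH-outNeighbour-unique : ∀ x {w w′} → inΓ x ≡ false → OffH w → OffH w′ →
    D (v x) w ≡ true → D (v x) w′ ≡ true → w ≡ w′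
  offH-outNeighbour-unique x {w} {w′} γ offH offH′ xw xw′ with w F.≟ w′
  ... | yes w≡w′ = w≡w′
  ... | no w≢w′ with outNeighbourOnH x γ
  ...   | z , xz = ⊥-elim (noThreeOutNeighbours (v x) (v z) w w′ (offH (idx z)) (offH′ (idx z)) w≢w′ xz xw xw′)

  twoOnH⇒noOffH-outNeighbour : ∀ x {w} → forward (x + L) ≡ false → forward x ≡ true → OffH w → D (v x) w ≢ true
  twoOnH⇒noOffH-outNeighbour x {w} f-pred fx offH xw =
    noThreeOutNeighbours (v x) (v (suc x)) (v (x + L)) w v[1+x]≢v[x+L] (offH _) (offH _) fx (arc-to-pred x f-pred) xw
    where
    v[1+x]≢v[x+L] : v (suc x) ≢ v (x + L)
    v[1+x]≢v[x+L] = v≢v (suc x) (x + L) (subst (_< x + L) (+-comm x 1) (+-monoʳ-< x (s≤s (s≤s z≤n))))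
                        (<-≤-trans (+-monoʳ-< x ≤-refl) (n≤1+n _))

  data CEdge (x y : ℕ) : Set where
    next   : y ≡ nextC x → CEdge x y
    wrap   : nextC y ≡ x + l → CEdge x y
    offH   : (w : Fin n) → OffH w → D (v x) w ≡ true → D (v y) w ≡ true → CEdge x y

  inΓ-suc-intro : ∀ x → D (v x) (v (suc x)) ≡ true → D (v (suc (suc x))) (v (suc x)) ≡ true →
    inΓ (suc x) ≡ true
  inΓ-suc-intro x fx b1+x = begin
    inΓ (suc x)                                  ≡⟨ inΓ-suc x ⟩
    forward x ∧ not (forward (suc x))            ≡⟨ cong (forward x ∧_) (sym (backward≡not-forward (suc x))) ⟩
    forward x ∧ D (v (suc (suc x))) (v (suc x))  ≡⟨ cong₂ _∧_ fx b1+x ⟩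
    true                                         ∎
    where open ≡-Reasoning

  module _ {x y : ℕ} (γx : inΓ x ≡ false) (γy : inΓ y ≡ false) (x<y : x < y) (y<x+l : y < x + l) where

    UAdj⇒CEdge : UAdj D (v x) (v y) → CEdge x y
    UAdj⇒CEdge adj with adjacent⇒consecutive x y x<y y<x+l adj
    ... | inj₁ refl      = next (sym (nextC-step x γy))
    ... | inj₂ 1+y≡x+l = wrap (trans (nextC-step y γ1+y) 1+y≡x+l)
      where γ1+y = trans (inΓ-cong (≡ₘ-trans (≡⇒≡ₘ 1+y≡x+l) (+l≡ₘ x))) γx

    commonOutNeighbourOnH⇒CEdge : ∀ u → x < u → u < x + l → D (v x) (v u) ≡ true → D (v y) (v u) ≡ true → CEdge x y
    commonOutNeighbourOnH⇒CEdge u x<u u<x+l xu yu with adjacent⇒consecutive x u x<u u<x+l (inj₁ xu) | <-cmp y u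
    ... | _ | tri≈ _ refl _ = contradiction yu (loopless _)
    ... | u≡1+x⊎ | tri< y<u _ _ with adjacent⇒consecutive y u y<u (<-≤-trans u<x+l (+-monoˡ-≤ l (<⇒≤ x<y))) (inj₁ yu)
    ...   | inj₂ 1+u≡y+l = contradiction (≤-trans (+-monoˡ-≤ l x<y) (≤-reflexive (sym 1+u≡y+l))) (<⇒≱ u<x+l ∘ ≤-pred)
    ...   | inj₁ refl with u≡1+x⊎
    ...     | inj₁ 1+y≡1+x = contradiction (suc-injective 1+y≡1+x) (<⇒≢ x<y ∘ sym)
    ...     | inj₂ 2+y≡x+l = wrap (trans (nextC-skip y (inΓ-suc-intro y yu back)) 2+y≡x+l)
      where back = subst (λ z → D z (v u) ≡ true) (sym (trans (cong v 2+y≡x+l) (v+l x))) xu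
    commonOutNeighbourOnH⇒CEdge u x<u u<x+l xu yu | u≡1+x⊎ | tri> _ _ u<y
        with adjacent⇒consecutive u y u<y (<-trans y<x+l (+-monoˡ-< l x<u)) (inj₂ yu)
    ...   | inj₂ 1+y≡u+l = contradiction (≤-trans (+-monoˡ-≤ l x<u) (≤-reflexive (sym 1+y≡u+l))) (<⇒≱ y<x+l ∘ ≤-pred)
    ...   | inj₁ refl with u≡1+x⊎
    ...     | inj₂ 1+u≡x+l = contradiction 1+u≡x+l (<⇒≢ y<x+l)
    ...     | inj₁ refl = next (sym (nextC-skip x (inΓ-suc-intro x xu yu)))

    PAdj⇒CEdge : PAdj D (v x) (v y) → CEdge x y
    PAdj⇒CEdge (_ , inj₁ adj) = UAdj⇒CEdge adj
    PAdj⇒CEdge (_ , inj₂ (w , xw , yw)) with FP.any? (λ c → h c F.≟ w)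
    ... | no ¬onH = offH w (λ c e → ¬onH (c , e)) xw yw
    ... | yes (c , hc≡w) with v-after x c
    ...   | u , x<u , u≤x+l , idx-u≡c with m≤n⇒m<n∨m≡n u≤x+l
    ...     | inj₁ u<x+l = commonOutNeighbourOnH⇒CEdge u x<u u<x+l (to-vu xw) (to-vu yw)
      where
      to-vu : ∀ {z} → D z w ≡ true → D z (v u) ≡ true
      to-vu {z} zw = subst (λ t → D z t ≡ true) (sym (trans (cong h idx-u≡c) hc≡w)) zw
    ...     | inj₂ refl = contradiction (subst (λ t → D (v x) t ≡ true) (trans (sym v[x+l]≡w) (v+l x)) xw) (loopless _)
      where
      v[x+l]≡w : v (x + l) ≡ w
      v[x+l]≡w = trans (cong h idx-u≡c) hc≡w

  onC⇒InC : ∀ t → inΓ t ≡ false → InC D h (v t)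
  onC⇒InC t γ = idx t , refl , λ deg≡2 →
    contradiction (trans (sym (inDegH≡ᵇ2 t)) (trans (cong (_≡ᵇ 2) deg≡2) (≡ᵇ-refl 2)))
                  (λ e → contradiction (trans (sym e) γ) λ ())

  HoleInC : Set
  HoleInC = HasHoleIn (PAdj D) (InC D h)

  module InducedCycle (p e : ℕ) (γp : inΓ p ≡ false) (γe : inΓ e ≡ false) (e<p+l : e < p + l)
    (adj-pe : PAdj D (v p) (v e)) (nextC-p<e : nextC p < e)
    (p-noChord : ∀ t → p < t → t < e → inΓ t ≡ false → t ≢ nextC p → ¬ PAdj D (v p) (v t))
    (¬adj-nextC-p-e : ¬ PAdj D (v (nextC p)) (v e)) where

    record IsFarthestNeighbour (y b : ℕ) : Set where
      field
        below    : y < b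
        notInΓ   : inΓ b ≡ false
        adjacent : PAdj D (v y) (v b)
        farthest : ∀ t → b < t → t ≤ e → inΓ t ≡ false → ¬ PAdj D (v y) (v t)

    NeighbourAtDistance : ℕ → ℕ → Set
    NeighbourAtDistance y j = (inΓ (e ∸ j) ≡ false) × PAdj D (v y) (v (e ∸ j))

    searchFarthest : ∀ y → MinimalBelow (NeighbourAtDistance y) (e ∸ y)
    searchFarthest y = minimalBelow _ (λ j → (inΓ (e ∸ j) B.≟ false) ×-dec PAdj? D _ _) (e ∸ y)

    farthestOf : ∀ y → MinimalBelow (NeighbourAtDistance y) (e ∸ y) → ℕ
    farthestOf y (found j _ _ _) = e ∸ j
    farthestOf y (none _)        = e

    farthestNeighbour : ℕ → ℕ
    farthestNeighbour y = farthestOf y (searchFarthest y)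

    farthestOf-spec : ∀ y → inΓ y ≡ false → y < e → (s : MinimalBelow (NeighbourAtDistance y) (e ∸ y)) →
      IsFarthestNeighbour y (farthestOf y s)
    farthestOf-spec y γy y<e (found j j<e-y (γ , adj) closer) = record
      { below = subst (_< e ∸ j) (m∸[m∸n]≡n (<⇒≤ y<e)) (∸-monoʳ-< j<e-y (m∸n≤m e y))
      ; notInΓ = γ ; adjacent = adj ; farthest = farther }
      where
      farther : ∀ t → e ∸ j < t → t ≤ e → inΓ t ≡ false → ¬ PAdj D (v y) (v t)
      farther t e-j<t t≤e γt adj-t = closer (e ∸ t) (∸-cancelʳ-< (subst (e ∸ j <_) (sym e-[e-t]≡t) e-j<t))
        (subst (λ z → inΓ z ≡ false) (sym e-[e-t]≡t) γt , subst (λ z → PAdj D (v y) (v z)) (sym e-[e-t]≡t) adj-t)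
        where e-[e-t]≡t = m∸[m∸n]≡n t≤e
    farthestOf-spec y γy y<e (none noNeighbour) = ⊥-elim (noNeighbour (e ∸ nextC y) (∸-monoʳ-< (x<nextC y) next≤e)
        (subst (λ z → inΓ z ≡ false) (sym e-[e-next]≡next) (nextC-onC y) ,
         subst (λ z → PAdj D (v y) (v z)) (sym e-[e-next]≡next) (PAdj-nextC y γy)))
      where
      next≤e = nextC-minimal y e y<e γe
      e-[e-next]≡next = m∸[m∸n]≡n next≤e

    farthestOf-bounds : ∀ y → y ≤ e → (s : MinimalBelow (NeighbourAtDistance y) (e ∸ y)) →
      y ≤ farthestOf y s × farthestOf y s ≤ e × inΓ (farthestOf y s) ≡ false
    farthestOf-bounds y y≤e (found j j<e-y (γ , _) _) =
      <⇒≤ (subst (_< e ∸ j) (m∸[m∸n]≡n y≤e) (∸-monoʳ-< j<e-y (m∸n≤m e y))) , m∸n≤m e j , γ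
    farthestOf-bounds y y≤e (none _) = y≤e , ≤-refl , γe

    walk : ℕ → ℕ
    walk zero    = nextC p
    walk (suc j) = farthestNeighbour (walk j)

    walk-bounds : ∀ j → walk j ≤ e × inΓ (walk j) ≡ false
    walk-bounds zero    = <⇒≤ nextC-p<e , nextC-onC p
    walk-bounds (suc j) = proj₂ (farthestOf-bounds (walk j) (proj₁ (walk-bounds j)) (searchFarthest (walk j)))

    walk≤e : ∀ j → walk j ≤ e
    walk≤e j = proj₁ (walk-bounds j)

    walk-onC : ∀ j → inΓ (walk j) ≡ false
    walk-onC j = proj₂ (walk-bounds j)

    walk-nondecreasing : ∀ j → walk j ≤ walk (suc j)
    walk-nondecreasing j = proj₁ (farthestOf-bounds (walk j) (walk≤e j) (searchFarthest (walk j)))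

    walk-step : ∀ j → walk j < e → IsFarthestNeighbour (walk j) (walk (suc j))
    walk-step j walk<e = farthestOf-spec (walk j) (walk-onC j) walk<e (searchFarthest (walk j))

    walk-grows : ∀ j → walk j < e → nextC p + j ≤ walk j
    walk-grows zero    _      = ≤-reflexive (+-identityʳ (nextC p))
    walk-grows (suc j) walk<e = begin
      nextC p + suc j   ≡⟨ +-suc (nextC p) j ⟩
      suc (nextC p + j) ≤⟨ s≤s (walk-grows j walk[j]<e) ⟩
      suc (walk j)      ≤⟨ IsFarthestNeighbour.below (walk-step j walk[j]<e) ⟩
      walk (suc j)      ∎
      where
      open ≤-Reasoning
      walk[j]<e = ≤-<-trans (walk-nondecreasing j) walk<e

    walk-reaches-e : walk (e ∸ nextC p) ≡ e
    walk-reaches-e with m≤n⇒m<n∨m≡n (walk≤e (e ∸ nextC p))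
    ... | inj₂ reached = reached
    ... | inj₁ walk<e  = contradiction (walk-grows _ walk<e) (<⇒≱ (subst (walk (e ∸ nextC p) <_) e≡p′+[e∸p′] walk<e))
      where e≡p′+[e∸p′] = sym (m+[n∸m]≡n (<⇒≤ nextC-p<e))

    module Arrival (r : ℕ) (arrives : walk r ≡ e) (notYet : ∀ j → j < r → walk j ≢ e) where

      walk<e : ∀ j → j < r → walk j < e
      walk<e j j<r = ≤∧≢⇒< (walk≤e j) (notYet j j<r)

      walk-advances : ∀ j → j < r → walk j < walk (suc j)
      walk-advances j j<r = IsFarthestNeighbour.below (walk-step j (walk<e j j<r))

      walk-increasing : ∀ j j′ → j < j′ → j′ ≤ r → walk j < walk j′
      walk-increasing j (suc j′) (s≤s j≤j′) 1+j′≤r with m≤n⇒m<n∨m≡n j≤j′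
      ... | inj₂ refl = walk-advances j 1+j′≤r
      ... | inj₁ j<j′ = <-trans (walk-increasing j j′ j<j′ (<⇒≤ 1+j′≤r)) (walk-advances j′ 1+j′≤r)

      p<walk : ∀ j → p < walk j
      p<walk zero    = x<nextC p
      p<walk (suc j) = <-≤-trans (p<walk j) (walk-nondecreasing j)

      2≤r : 2 ≤ r
      2≤r = arrival-late r arrives
        where
        arrival-late : ∀ r′ → walk r′ ≡ e → 2 ≤ r′
        arrival-late zero        walk0≡e = contradiction walk0≡e (<⇒≢ nextC-p<e)
        arrival-late (suc zero)  walk1≡e = ⊥-elim (¬adj-nextC-p-e (subst (λ z → PAdj D (v (nextC p)) (v z)) walk1≡e
                                             (IsFarthestNeighbour.adjacent (walk-step 0 nextC-p<e))))
        arrival-late (suc (suc _)) _     = s≤s (s≤s z≤n)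

      vertex : ℕ → ℕ
      vertex zero    = p
      vertex (suc j) = walk j

      M : ℕ
      M = suc (suc r)

      p≤vertex : ∀ j → p ≤ vertex j
      p≤vertex zero    = ≤-refl
      p≤vertex (suc j) = <⇒≤ (p<walk j)

      vertex≤e : ∀ j → j < M → vertex j ≤ e
      vertex≤e zero    _ = <⇒≤ (<-trans (x<nextC p) nextC-p<e)
      vertex≤e (suc j) _ = walk≤e j

      vertex-increasing : ∀ j j′ → j < j′ → j′ < M → vertex j < vertex j′
      vertex-increasing zero    (suc j′) _         _                 = p<walk j′
      vertex-increasing (suc j) (suc j′) (s≤s j<j′) (s≤s (s≤s j′≤r)) = walk-increasing j j′ j<j′ j′≤r

      vertex-distinct : ∀ j j′ → j < j′ → j′ < M → v (vertex j) ≢ v (vertex j′)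
      vertex-distinct j j′ j<j′ j′<M = v≢v _ _ (vertex-increasing j j′ j<j′ j′<M)
        (<-≤-trans (≤-<-trans (vertex≤e j′ j′<M) e<p+l) (+-monoˡ-≤ l (p≤vertex j)))

      onlyConsecutiveAdjacent : ∀ j j′ → j < j′ → j′ < M → PAdj D (v (vertex j)) (v (vertex j′)) →
        CyclicallyConsecutive M j j′
      onlyConsecutiveAdjacent zero (suc zero) _ _ _ = inj₁ refl
      onlyConsecutiveAdjacent zero (suc (suc j′)) _ (s≤s (s≤s 1+j′≤r)) adj with m≤n⇒m<n∨m≡n 1+j′≤r
      ... | inj₂ refl    = inj₂ (refl , refl)
      ... | inj₁ 1+j′<r = ⊥-elim (p-noChord (walk (suc j′)) (p<walk (suc j′)) (walk<e (suc j′) 1+j′<r) (walk-onC (suc j′))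
                             (<⇒≢ (walk-increasing 0 (suc j′) z<s (<⇒≤ 1+j′<r)) ∘ sym) adj)
      onlyConsecutiveAdjacent (suc j) (suc j′) (s≤s j<j′) (s≤s (s≤s j′≤r)) adj with m≤n⇒m<n∨m≡n j<j′
      ... | inj₂ refl     = inj₁ refl
      ... | inj₁ 1+j<j′ = ⊥-elim (IsFarthestNeighbour.farthest (walk-step j (walk<e j (<-≤-trans j<j′ j′≤r)))
                              (walk j′) (walk-increasing (suc j) j′ 1+j<j′ j′≤r) (walk≤e j′) (walk-onC j′) adj)

      consecutiveAdjacent : ∀ j j′ → j < j′ → j′ < M → CyclicallyConsecutive M j j′ →
        PAdj D (v (vertex j)) (v (vertex j′))
      consecutiveAdjacent zero    .1               _ _ (inj₁ refl) = PAdj-nextC p γp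
      consecutiveAdjacent (suc j) .(suc (suc j)) _ (s≤s (s≤s 1+j≤r)) (inj₁ refl) =
        IsFarthestNeighbour.adjacent (walk-step j (walk<e j 1+j≤r))
      consecutiveAdjacent zero    .(suc r)       _ _ (inj₂ (refl , refl)) = subst (λ z → PAdj D (v p) (v z)) (sym arrives) adj-pe

      inducedHole : HoleInC
      inducedHole = M , v ∘ vertex ∘ toℕ ,
             isHole-fromSequence (PAdj D) (PAdj-sym D) (PAdj-irrefl D) M (s≤s (s≤s 2≤r)) (v ∘ vertex)
               vertex-distinct onlyConsecutiveAdjacent consecutiveAdjacent ,
             λ a → onC⇒InC (vertex (toℕ a)) (vertex-onC (toℕ a))
        where
        vertex-onC : ∀ j → inΓ (vertex j) ≡ false
        vertex-onC zero    = γp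
        vertex-onC (suc j) = walk-onC j

    holeInC : HoleInC
    holeInC with minimalBelow (λ j → walk j ≡ e) (λ j → walk j ≟ e) (suc (e ∸ nextC p))
    ... | found r _ arrives notYet = Arrival.inducedHole r arrives notYet
    ... | none neverArrives         = ⊥-elim (neverArrives (e ∸ nextC p) ≤-refl walk-reaches-e)

  sizeC≤3 : ∀ p → inΓ p ≡ false → nextC (nextC (nextC p)) ≡ p + l → sizeC ≤ 3
  sizeC≤3 p γp wraps = begin
      countBelow l onC
    ≡⟨ countBelow-periodic l onC (λ x → onC-cong (≡ₘ-trans (≡⇒≡ₘ (+-comm l x)) (+l≡ₘ x))) p ⟨
      countBelow l (λ j → onC (p + j))
    ≤⟨ countBelow-mono l onC⇒listed ⟩
      countBelow l (λ j → any (p + j ≡ᵇ_) (p ∷ s₁ ∷ s₂ ∷ []))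
    ≤⟨ countBelow-any≤length l p (p ∷ s₁ ∷ s₂ ∷ []) ⟩
      3 ∎
    where
    open ≤-Reasoning
    s₁ = nextC p
    s₂ = nextC s₁
    onC⇒∈ : ∀ j → j < l → onC (p + j) ≡ true → p + j ∈ p ∷ s₁ ∷ s₂ ∷ []
    onC⇒∈ j j<l onC-t with m≤n⇒m<n∨m≡n (m≤m+n p j)
    ... | inj₂ p≡t = here (sym p≡t)
    ... | inj₁ p<t with m≤n⇒m<n∨m≡n (nextC-minimal p (p + j) p<t (not-injective onC-t))
    ...   | inj₂ s₁≡t = there (here (sym s₁≡t))
    ...   | inj₁ s₁<t with m≤n⇒m<n∨m≡n (nextC-minimal s₁ (p + j) s₁<t (not-injective onC-t))
    ...     | inj₂ s₂≡t = there (there (here (sym s₂≡t)))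
    ...     | inj₁ s₂<t = contradiction (subst (_≤ p + j) wraps (nextC-minimal s₂ (p + j) s₂<t (not-injective onC-t)))
                            (<⇒≱ (+-monoʳ-< p j<l))
    onC⇒listed : ∀ j → j < l → onC (p + j) ≡ true → any (p + j ≡ᵇ_) (p ∷ s₁ ∷ s₂ ∷ []) ≡ true
    onC⇒listed j j<l onC-t = ∈⇒any≡ᵇ (p + j) _ (onC⇒∈ j j<l onC-t)

  NoSharedOffH : ℕ → Set
  NoSharedOffH q = ∀ w t → OffH w → D (v q) w ≡ true → q < t → t < q + l → inΓ t ≡ false → D (v t) w ≢ true

  PAdj-prevC : ∀ q → inΓ q ≡ false → PAdj D (v q) (v (prevC q))
  PAdj-prevC q γq = PAdj-sym D _ _ (subst (λ z → PAdj D (v (prevC q)) z) v[next[prev]]≡v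
                                      (PAdj-nextC (prevC q) (prevC-onC q)))
    where v[next[prev]]≡v = trans (cong v (nextC-prevC q γq)) (v+l q)

  holeAround : ∀ q → inΓ q ≡ false → NoSharedOffH q → ¬ PAdj D (v (nextC q)) (v (prevC q)) → HoleInC
  holeAround q γq noShared ¬adj = InducedCycle.holeInC q (prevC q) γq (prevC-onC q) (prevC<x+l q)
    (PAdj-prevC q γq) (nextC<prevC q) noChord ¬adj
    where
    noChord : ∀ t → q < t → t < prevC q → inΓ t ≡ false → t ≢ nextC q → ¬ PAdj D (v q) (v t)
    noChord t q<t t<prev γt t≢next adj with PAdj⇒CEdge γq γt q<t (<-trans t<prev (prevC<x+l q)) adj
    ... | next t≡next = t≢next t≡next
    ... | wrap next-t≡q+l = nextC-nothingBetween t (prevC q) t<prev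
                              (subst (prevC q <_) (sym next-t≡q+l) (prevC<x+l q)) (prevC-onC q)
    ... | offH w offH-w qw tw = noShared w t offH-w qw q<t (<-trans t<prev (prevC<x+l q)) γt tw

  4≤sizeC⇒offH-chord : 4 ≤ sizeC → ∀ q → inΓ q ≡ false → PAdj D (v (nextC q)) (v (prevC q)) →
    Σ (Fin n) λ w → OffH w × D (v (nextC q)) w ≡ true × D (v (prevC q)) w ≡ true
  4≤sizeC⇒offH-chord 4≤|C| q γq adj with PAdj⇒CEdge (nextC-onC q) (prevC-onC q) (nextC<prevC q)
                                           (<-≤-trans (prevC<x+l q) (+-monoˡ-≤ l (<⇒≤ (x<nextC q)))) adj
  ... | next prev≡next² =
    contradiction (≤-trans 4≤|C| (sizeC≤3 q γq (trans (cong nextC (sym prev≡next²)) (nextC-prevC q γq))))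
                  (<⇒≱ ≤-refl)
  ... | wrap next[prev]≡next+l =
    contradiction (+-cancelʳ-≡ l q (nextC q) (trans (sym (nextC-prevC q γq)) next[prev]≡next+l))
                  (<⇒≢ (x<nextC q))
  ... | offH w offH-w nw pw = w , offH-w , nw , pw

  -- These describe v (suc t): a sink, a source, or no change of orientation of the hole.
  sink source level : ℕ → Bool
  sink   t = forward t ∧ not (forward (suc t))
  source t = not (forward t) ∧ forward (suc t)
  level  t = not (sink t ∨ source t)

  countΓ≡countSink : countBelow l inΓ ≡ countBelow l sink
  countΓ≡countSink = trans (sym (countBelow-rotate l inΓ (inΓ-cong (+l≡ₘ 0))))
                           (countBelow-cong l (λ t _ → inΓ-suc t))

  countSink≡countSource : countBelow l sink ≡ countBelow l source
  countSink≡countSource = +-cancelʳ-≡ (countBelow l forward) _ _ (begin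
      countBelow l sink + countBelow l forward
    ≡⟨ cong (countBelow l sink +_) (countBelow-rotate l forward (forward-cong (+l≡ₘ 0))) ⟨
      countBelow l sink + countBelow l (forward ∘ suc)
    ≡⟨ countBelow-additive l sink (forward ∘ suc) source forward (λ t _ → transitions (forward t) (forward (suc t))) ⟩
      countBelow l source + countBelow l forward ∎)
    where
    open ≡-Reasoning
    transitions : ∀ a b → bit (a ∧ not b) + bit b ≡ bit (not a ∧ b) + bit a
    transitions true  true  = refl
    transitions true  false = refl
    transitions false true  = refl
    transitions false false = refl

  sink+source+level : countBelow l sink + countBelow l source + countBelow l level ≡ l
  sink+source+level = trans
    (cong (_+ countBelow l level) (countBelow-disjoint l sink source (λ t _ → exclusive (forward t) (forward (suc t)))))
    (countBelow-complement l (λ t → sink t ∨ source t))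
    where
    exclusive : ∀ a b → (a ∧ not b) ∧ (not a ∧ b) ≡ false
    exclusive true  b = ∧-zeroʳ (not b)
    exclusive false b = refl

  source⇒forward : ∀ t → source t ≡ true → forward t ≡ false × forward (suc t) ≡ true
  source⇒forward t src with forward t | forward (suc t)
  ... | false | true = refl , refl

  twoSources : ℕ → Bool
  twoSources t = source t ∧ source (suc (suc t))

  level-equal : ∀ x → forward x ≡ forward (suc x) → level x ≡ true
  level-equal x e = trans (cong (λ b → not ((forward x ∧ not b) ∨ (not (forward x) ∧ b))) (sym e)) (no-transition (forward x))
    where
    no-transition : ∀ a → not ((a ∧ not a) ∨ (not a ∧ a)) ≡ true
    no-transition true  = refl
    no-transition false = refl

  countSource≤countLevel : (∀ t → t < l → twoSources t ≡ false) → countBelow l source ≤ countBelow l level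
  countSource≤countLevel noTwoSources = countBelow-injectionₘ source level level-cong after source⇒level after-injective
    where
    level-cong : ∀ {x y} → x ≡ₘ y → level x ≡ level y
    level-cong e = cong₂ (λ a b → not ((a ∧ not b) ∨ (not a ∧ b))) (forward-cong e) (forward-cong (≡ₘ-suc e))
    -- A source at t + 1 is followed by a level position at t + 1 or t + 2, unless a source sits at t + 3.
    after : ℕ → ℕ
    after t = if forward (suc (suc t)) then suc t else suc (suc t)
    data AfterView (t : ℕ) : Set where
      one : forward (suc (suc t)) ≡ true  → after t ≡ suc t       → AfterView t
      two : forward (suc (suc t)) ≡ false → after t ≡ suc (suc t) → AfterView t
    after-view : ∀ t → AfterView t
    after-view t with forward (suc (suc t)) B.≟ true
    ... | yes f  = one f (cong (λ b → if b then suc t else suc (suc t)) f)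
    ... | no ¬f = two (B.¬-not ¬f) (cong (λ b → if b then suc t else suc (suc t)) (B.¬-not ¬f))
    source⇒level : ∀ t → t < l → source t ≡ true → level (after t) ≡ true
    source⇒level t t<l src with after-view t
    ... | one f₂ a = subst (λ z → level z ≡ true) (sym a)
                       (level-equal (suc t) (trans (proj₂ (source⇒forward t src)) (sym f₂)))
    ... | two f₂ a with forward (suc (suc (suc t))) B.≟ true
    ...   | no ¬f₃ = subst (λ z → level z ≡ true) (sym a) (level-equal (suc (suc t)) (trans f₂ (sym (B.¬-not ¬f₃))))
    ...   | yes f₃ = contradiction (trans (sym (noTwoSources t t<l)) (cong₂ _∧_ src (cong₂ (λ a b → not a ∧ b) f₂ f₃))) λ ()
    clash : ∀ t t′ → source t ≡ true → suc t ≡ₘ suc (suc t′) → forward (suc (suc t′)) ≢ false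
    clash t t′ src e f = contradiction (trans (sym (proj₂ (source⇒forward t src))) (trans (forward-cong e) f)) λ ()
    after-injective : ∀ t t′ → t < l → t′ < l → source t ≡ true → source t′ ≡ true → after t ≡ₘ after t′ → t ≡ t′
    after-injective t t′ t<l t′<l src src′ e with after-view t | after-view t′
    ... | one _ a  | one _ a′  = ≡ₘ-below-l t<l t′<l (≡ₘ-suc⁻¹ (subst₂ _≡ₘ_ a a′ e))
    ... | two _ a  | two _ a′  = ≡ₘ-below-l t<l t′<l (≡ₘ-suc⁻¹ (≡ₘ-suc⁻¹ (subst₂ _≡ₘ_ a a′ e)))
    ... | one _ a  | two f′ a′ = ⊥-elim (clash t t′ src (subst₂ _≡ₘ_ a a′ e) f′)
    ... | two f a  | one _ a′  = ⊥-elim (clash t′ t src′ (subst₂ _≡ₘ_ a′ a (≡ₘ-sym e)) f)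

  3*countΓ≤l : (∀ t → t < l → twoSources t ≡ false) → 3 * countBelow l inΓ ≤ l
  3*countΓ≤l noTwoSources = begin
      3 * countBelow l inΓ
    ≡⟨ cong (3 *_) countΓ≡countSink ⟩
      #sink + (#sink + (#sink + 0))
    ≡⟨ cong (λ z → #sink + (z + (z + 0))) countSink≡countSource ⟩
      #sink + (#source + (#source + 0))
    ≤⟨ +-monoʳ-≤ #sink (+-monoʳ-≤ #source
         (≤-trans (≤-reflexive (+-identityʳ _)) (countSource≤countLevel noTwoSources))) ⟩
      #sink + (#source + countBelow l level)
    ≡⟨ +-assoc #sink _ _ ⟨
      #sink + #source + countBelow l level
    ≡⟨ sink+source+level ⟩
      l ∎
    where
    open ≤-Reasoning
    #sink = countBelow l sink
    #source = countBelow l source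

  source⇒noOffH-outNeighbour : ∀ t {w} → source t ≡ true → OffH w → D (v (suc t)) w ≢ true
  source⇒noOffH-outNeighbour t src = twoOnH⇒noOffH-outNeighbour (suc t)
    (trans (forward-pred t) (proj₁ (source⇒forward t src))) (proj₂ (source⇒forward t src))

  holeAtTwoSources : 4 ≤ sizeC → ∀ t → twoSources t ≡ true → HoleInC
  holeAtTwoSources 4≤|C| t two = holeAround p γp noShared ¬adj
    where
    src₀ : source t ≡ true
    src₀ = B.∧-conicalˡ (source t) _ two
    src₂ : source (suc (suc t)) ≡ true
    src₂ = B.∧-conicalʳ (source t) _ two
    p = suc t
    γp : inΓ p ≡ false
    γp = trans (inΓ-suc t) (cong (_∧ not (forward p)) (proj₁ (source⇒forward t src₀)))
    noShared : NoSharedOffH p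
    noShared w _ offH-w pw _ _ _ _ = source⇒noOffH-outNeighbour t src₀ offH-w pw
    nextC-p : nextC p ≡ suc (suc p)
    nextC-p = nextC-skip p (trans (inΓ-suc p)
      (cong₂ (λ a b → a ∧ not b) (proj₂ (source⇒forward t src₀)) (proj₁ (source⇒forward (suc (suc t)) src₂))))
    ¬adj : ¬ PAdj D (v (nextC p)) (v (prevC p))
    ¬adj adj with 4≤sizeC⇒offH-chord 4≤|C| p γp adj
    ... | w , offH-w , nw , _ =
      source⇒noOffH-outNeighbour (suc (suc t)) src₂ offH-w (subst (λ z → D (v z) w ≡ true) nextC-p nw)

  holeIfManyΓ : 4 ≤ sizeC → l < 3 * countBelow l inΓ → HoleInC
  holeIfManyΓ 4≤|C| many with minimalBelow (λ t → twoSources t ≡ true) (λ t → twoSources t B.≟ true) l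
  ... | found t _ two _ = holeAtTwoSources 4≤|C| t two
  ... | none noTwo      = contradiction (3*countΓ≤l (λ t t<l → B.¬-not (noTwo t t<l))) (<⇒≱ many)

  suc+<+l : ∀ q j → j < L → suc q + j < q + l
  suc+<+l q j j<L = subst (suc q + j <_) (suc[+L] q) (s≤s (+-monoʳ-< q j<L))

  window-offset : ∀ q t → q < t → t < q + l → t ∸ suc q < L × suc q + (t ∸ suc q) ≡ t
  window-offset q t q<t t<q+l = +-cancelˡ-< q (t ∸ suc q) L (≤-pred (subst₂ _<_ (sym e) (sym (suc[+L] q)) t<q+l)) , e
    where
    e : suc q + (t ∸ suc q) ≡ t
    e = m+[n∸m]≡n q<t

  module IntoOffH (w : Fin n) (offH-w : OffH w) where

    intoW : ℕ → Bool
    intoW t = onC t ∧ D (v t) w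

    intoW-cong : ∀ {x y} → x ≡ₘ y → intoW x ≡ intoW y
    intoW-cong e = cong₂ _∧_ (onC-cong e) (cong (λ u → D u w) (v-cong e))

    intoW⇒onC : ∀ t → intoW t ≡ true → inΓ t ≡ false
    intoW⇒onC t K = not-injective (B.∧-conicalˡ (onC t) _ K)

    intoW⇒arc : ∀ t → intoW t ≡ true → D (v t) w ≡ true
    intoW⇒arc t K = B.∧-conicalʳ (onC t) _ K

    intoW-intro : ∀ t → inΓ t ≡ false → D (v t) w ≡ true → intoW t ≡ true
    intoW-intro t γ arc = cong₂ _∧_ (cong not γ) arc

    record IsNextIntoW (k e : ℕ) : Set where
      field
        after   : k < e
        within  : e < k + l
        into    : intoW e ≡ true
        nothingBetween : ∀ t → k < t → t < e → intoW t ≡ false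

    module TwoIntoW (k₁ k₂ : ℕ) (k₁<k₂ : k₁ < k₂) (k₂<k₁+l : k₂ < k₁ + l)
      (K₁ : intoW k₁ ≡ true) (K₂ : intoW k₂ ≡ true) where

      intoW-after : ∀ k → Σ ℕ λ u → k < u × u < k + l × intoW u ≡ true
      intoW-after k with representativeAfter k k₁ | representativeAfter k k₂
      ... | u₁ , k<u₁ , u₁≤k+l , u₁≡k₁ | u₂ , k<u₂ , u₂≤k+l , u₂≡k₂
          with m≤n⇒m<n∨m≡n u₁≤k+l | m≤n⇒m<n∨m≡n u₂≤k+l
      ...   | inj₁ u₁<k+l | _ = u₁ , k<u₁ , u₁<k+l , trans (intoW-cong u₁≡k₁) K₁
      ...   | inj₂ _ | inj₁ u₂<k+l = u₂ , k<u₂ , u₂<k+l , trans (intoW-cong u₂≡k₂) K₂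
      ...   | inj₂ refl | inj₂ refl =
        contradiction (≡ₘ-window k₁ k₂ (<⇒≤ k₁<k₂) k₂<k₁+l (≡ₘ-trans (≡ₘ-sym u₁≡k₁) u₂≡k₂)) (<⇒≢ k₁<k₂)

      searchNext : ∀ k → MinimalBelow (λ j → intoW (suc k + j) ≡ true) L
      searchNext k = minimalBelow _ (λ j → intoW (suc k + j) B.≟ true) L

      nextOf : ∀ k → MinimalBelow (λ j → intoW (suc k + j) ≡ true) L → ℕ
      nextOf k (found j _ _ _) = suc k + j
      nextOf k (none _)        = k + l

      nextIntoW : ℕ → ℕ
      nextIntoW k = nextOf k (searchNext k)

      nextOf-spec : ∀ k s → IsNextIntoW k (nextOf k s)
      nextOf-spec k (found j j<L K before) = record
        { after = s≤s (m≤m+n k j) ; within = suc+<+l k j j<L ; into = K ; nothingBetween = nothingBetween }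
        where
        nothingBetween : ∀ t → k < t → t < suc k + j → intoW t ≡ false
        nothingBetween t k<t t<next with intoW t B.≟ true
        ... | no ¬K = B.¬-not ¬K
        ... | yes Kt = ⊥-elim (before (t ∸ suc k) (+-cancelˡ-< (suc k) _ _ (subst (_< suc k + j) (sym (m+[n∸m]≡n k<t)) t<next))
                                (subst (λ z → intoW z ≡ true) (sym (m+[n∸m]≡n k<t)) Kt))
      nextOf-spec k (none never) with intoW-after k
      ... | u , k<u , u<k+l , Ku with window-offset k u k<u u<k+l
      ...   | j<L , e = ⊥-elim (never (u ∸ suc k) j<L (subst (λ z → intoW z ≡ true) (sym e) Ku))

      nextIntoW-spec : ∀ k → IsNextIntoW k (nextIntoW k)
      nextIntoW-spec k = nextOf-spec k (searchNext k)

      holeBeforeNextIntoW : ∀ k → intoW k ≡ true → nextC (nextC k) < nextIntoW k → HoleInC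
      holeBeforeNextIntoW k Kk long =
        InducedCycle.holeInC k e γk γe within adj-ke nextC-k<e noChord ¬adj-nextC-k-e
        where
        e = nextIntoW k
        open IsNextIntoW (nextIntoW-spec k)
        γk = intoW⇒onC k Kk
        γe = intoW⇒onC e into
        adj-ke : PAdj D (v k) (v e)
        adj-ke = v≢v k e after within , inj₂ (w , intoW⇒arc k Kk , intoW⇒arc e into)
        nextC-k<e : nextC k < e
        nextC-k<e = <-trans (x<nextC (nextC k)) long
        only-w : ∀ {w′} → OffH w′ → D (v k) w′ ≡ true → w′ ≡ w
        only-w offH-w′ kw′ = offH-outNeighbour-unique k γk offH-w′ offH-w kw′ (intoW⇒arc k Kk)
        noChord : ∀ t → k < t → t < e → inΓ t ≡ false → t ≢ nextC k → ¬ PAdj D (v k) (v t)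
        noChord t k<t t<e γt t≢next adj with PAdj⇒CEdge γk γt k<t (<-trans t<e within) adj
        ... | next t≡next = t≢next t≡next
        ... | wrap next-t≡k+l = nextC-nothingBetween t e t<e (subst (e <_) (sym next-t≡k+l) within) γe
        ... | offH w′ offH-w′ kw′ tw′ =
          contradiction (intoW-intro t γt (subst (λ z → D (v t) z ≡ true) (only-w offH-w′ kw′) tw′))
                        (B.not-¬ (nothingBetween t k<t t<e))
        ¬adj-nextC-k-e : ¬ PAdj D (v (nextC k)) (v e)
        ¬adj-nextC-k-e adj
          with PAdj⇒CEdge (nextC-onC k) γe nextC-k<e (<-≤-trans within (+-monoˡ-≤ l (<⇒≤ (x<nextC k)))) adj
        ... | next e≡next² = <⇒≢ long (sym e≡next²)
        ... | wrap next-e≡next+l = nextC-nothingBetween e (k + l) within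
                (subst (k + l <_) (sym next-e≡next+l) (+-monoˡ-< l (x<nextC k))) (trans (inΓ-cong (+l≡ₘ k)) γk)
        ... | offH w′ offH-w′ nw′ ew′ =
          contradiction (intoW-intro (nextC k) (nextC-onC k) (subst (λ z → D (v (nextC k)) z ≡ true) w′≡w nw′))
                        (B.not-¬ (nothingBetween (nextC k) (x<nextC k) nextC-k<e))
          where
          w′≡w = offH-outNeighbour-unique e γe offH-w′ offH-w ew′ (intoW⇒arc e into)

      lastIntoWBefore : ∀ x → intoW (x + l) ≡ false →
        Σ ℕ λ k → x < k × k < x + l × intoW k ≡ true × (∀ t → k < t → t < x + l → intoW t ≡ false)
      lastIntoWBefore x ¬K[x+l]
        with minimalBelow (λ j → intoW (x + L ∸ j) ≡ true) (λ j → intoW (x + L ∸ j) B.≟ true) L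
      ... | none never with intoW-after x
      ...   | u , x<u , u<x+l , Ku =
        ⊥-elim (never (x + L ∸ u) j<L (subst (λ z → intoW z ≡ true) (sym (m∸[m∸n]≡n u≤x+L)) Ku))
        where
        u≤x+L = ≤-pred (subst (u <_) (sym (suc[+L] x)) u<x+l)
        j<L = subst (x + L ∸ u <_) (m+n∸m≡n x L) (∸-monoʳ-< x<u u≤x+L)
      lastIntoWBefore x ¬K[x+l] | found j j<L K later =
        x + L ∸ j , x<k , ≤-<-trans (m∸n≤m (x + L) j) (+-monoʳ-< x ≤-refl) , K , nothingAfter
        where
        x<k : x < x + L ∸ j
        x<k = subst (x <_) (sym (+-∸-assoc x (<⇒≤ j<L))) (m<m+n x (m<n⇒0<n∸m j<L))
        nothingAfter : ∀ t → x + L ∸ j < t → t < x + l → intoW t ≡ false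
        nothingAfter t k<t t<x+l with intoW t B.≟ true
        ... | no ¬Kt = B.¬-not ¬Kt
        ... | yes Kt = ⊥-elim (later (x + L ∸ t) (subst (x + L ∸ t <_) (m∸[m∸n]≡n j≤x+L) (∸-monoʳ-< k<t t≤x+L))
                                (subst (λ z → intoW z ≡ true) (sym (m∸[m∸n]≡n t≤x+L)) Kt))
          where
          t≤x+L = ≤-pred (subst (t <_) (sym (suc[+L] x)) t<x+l)
          j≤x+L = ≤-trans (<⇒≤ j<L) (m≤n+m L x)

      module AllGapsShort (short : ∀ k → k < l + l → intoW k ≡ true → nextIntoW k ≤ nextC (nextC k)) where

        prevC-intoW : ∀ x → x < l → inΓ x ≡ false → intoW x ≡ false → intoW (prevC x) ≡ true
        prevC-intoW x x<l γx ¬Kx with intoW (prevC x) B.≟ true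
        ... | yes K = K
        ... | no ¬K with lastIntoWBefore x (trans (intoW-cong (+l≡ₘ x)) ¬Kx)
        ...   | k , x<k , k<x+l , Kk , nothingAfter = ⊥-elim (<⇒≱ next>x+l (≤-trans (short k k<2l Kk) nextC²k≤x+l))
          where
          k<prev : k < prevC x
          k<prev with <-cmp k (prevC x)
          ... | tri< k<p _ _ = k<p
          ... | tri≈ _ k≡p _ = contradiction (trans (cong intoW (sym k≡p)) Kk) ¬K
          ... | tri> _ _ p<k = ⊥-elim (nextC-nothingBetween (prevC x) k p<k (subst (k <_) (sym (nextC-prevC x γx)) k<x+l)
                                         (intoW⇒onC k Kk))
          k<2l : k < l + l
          k<2l = <-trans k<x+l (+-monoˡ-< l x<l)
          nextC²k≤x+l : nextC (nextC k) ≤ x + l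
          nextC²k≤x+l = subst (nextC (nextC k) ≤_) (nextC-prevC x γx)
                          (nextC-mono (nextC k) (prevC x) (nextC-minimal k (prevC x) k<prev (prevC-onC x)))
          open IsNextIntoW (nextIntoW-spec k)
          next>x+l : x + l < nextIntoW k
          next>x+l with <-cmp (nextIntoW k) (x + l)
          ... | tri< n<x+l _ _ = contradiction (trans (sym into) (nothingAfter _ after n<x+l)) λ ()
          ... | tri≈ _ n≡x+l _ =
            contradiction (trans (sym into) (trans (cong intoW n≡x+l) (trans (intoW-cong (+l≡ₘ x)) ¬Kx))) λ ()
          ... | tri> _ _ x+l<n = x+l<n

        onC∖intoW : ℕ → Bool
        onC∖intoW t = onC t ∧ not (intoW t)

        sizeC≡ : sizeC ≡ countBelow l intoW + countBelow l onC∖intoW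
        sizeC≡ = begin
            countBelow l onC
          ≡⟨ +-identityʳ _ ⟨
            countBelow l onC + 0
          ≡⟨ cong (countBelow l onC +_) (countBelow-false l) ⟨
            countBelow l onC + countBelow l (λ _ → false)
          ≡⟨ countBelow-additive l onC (λ _ → false) intoW onC∖intoW (λ t _ → split (onC t) (D (v t) w)) ⟩
            countBelow l intoW + countBelow l onC∖intoW ∎
          where
          open ≡-Reasoning
          split : ∀ a b → bit a + bit false ≡ bit (a ∧ b) + bit (a ∧ not (a ∧ b))
          split true  true  = refl
          split true  false = refl
          split false _     = refl

        count∖≤countIntoW : countBelow l onC∖intoW ≤ countBelow l intoW
        count∖≤countIntoW = countBelow-injectionₘ onC∖intoW intoW intoW-cong prevC toIntoW prevC-injective
          where
          toIntoW : ∀ t → t < l → onC∖intoW t ≡ true → intoW (prevC t) ≡ true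
          toIntoW t t<l x = prevC-intoW t t<l (not-injective (B.∧-conicalˡ (onC t) _ x))
                                               (not-injective (B.∧-conicalʳ (onC t) _ x))
          prevC-injective : ∀ t t′ → t < l → t′ < l → onC∖intoW t ≡ true → onC∖intoW t′ ≡ true →
                            prevC t ≡ₘ prevC t′ → t ≡ t′
          prevC-injective t t′ t<l t′<l x x′ e = ≡ₘ-below-l t<l t′<l (≡ₘ-trans (≡ₘ-sym (+l≡ₘ t))
            (≡ₘ-trans (subst₂ _≡ₘ_ (nextC-prevC t (γ t x)) (nextC-prevC t′ (γ t′ x′)) (nextC-cong e)) (+l≡ₘ t′)))
            where
            γ : ∀ s → onC∖intoW s ≡ true → inΓ s ≡ false
            γ s x = not-injective (B.∧-conicalˡ (onC s) _ x)

        countIntoW≤indeg : countBelow l intoW ≤ indeg D w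
        countIntoW≤indeg = subst (_≤ indeg D w) (count≡countBelow {l} (intoW ∘ toℕ) intoW (λ _ → refl))
          (count-injection (intoW ∘ toℕ) (λ u → D u w) h arc (λ a b _ _ e → proj₁ (proj₂ h-hole) a b e))
          where
          arc : ∀ a → intoW (toℕ a) ≡ true → D (h a) w ≡ true
          arc a K = subst (λ c → D (h c) w ≡ true) (idx-toℕ a) (intoW⇒arc (toℕ a) K)

        sizeC≤2*indeg : sizeC ≤ indeg D w + indeg D w
        sizeC≤2*indeg = begin
          sizeC                                                   ≡⟨ sizeC≡ ⟩
          countBelow l intoW + countBelow l onC∖intoW             ≤⟨ +-monoʳ-≤ (countBelow l intoW) count∖≤countIntoW ⟩
          countBelow l intoW + countBelow l intoW                 ≤⟨ +-mono-≤ countIntoW≤indeg countIntoW≤indeg ⟩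
          indeg D w + indeg D w                                   ∎
          where open ≤-Reasoning

      -- Gaps below l + l suffice: prevC-intoW only looks at intoW-positions in (x, x + l) with x < l.
      holeFromTwoIntoW : ∀ i → indeg D w ≤ i → 2 * i + 1 ≤ sizeC → HoleInC
      holeFromTwoIntoW i indeg≤i big
        with minimalBelow (λ k → intoW k ≡ true × nextC (nextC k) < nextIntoW k)
                          (λ k → (intoW k B.≟ true) ×-dec (nextC (nextC k) <? nextIntoW k)) (l + l)
      ... | found k _ (Kk , long) _ = holeBeforeNextIntoW k Kk long
      ... | none allShort =
        contradiction (≤-trans big (≤-trans (AllGapsShort.sizeC≤2*indeg short) (+-mono-≤ indeg≤i indeg≤i)))
                              (<⇒≱ (subst (_< 2 * i + 1) (cong (i +_) (+-identityʳ i)) (m<m+n (i + (i + 0)) z<s)))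
        where
        short : ∀ k → k < l + l → intoW k ≡ true → nextIntoW k ≤ nextC (nextC k)
        short k k<2l Kk = ≮⇒≥ (λ long → allShort k k<2l (Kk , long))

  module LargeC (i : ℕ) (indeg≤i : ∀ u → indeg D u ≤ i) (4≤|C| : 4 ≤ sizeC) (big : 2 * i + 1 ≤ sizeC) where

    holeFromTwoIntoW : ∀ w → OffH w → ∀ k₁ k₂ → k₁ < k₂ → k₂ < k₁ + l →
      inΓ k₁ ≡ false → D (v k₁) w ≡ true → inΓ k₂ ≡ false → D (v k₂) w ≡ true → HoleInC
    holeFromTwoIntoW w offH-w k₁ k₂ k₁<k₂ k₂<k₁+l γ₁ arc₁ γ₂ arc₂ =
      TwoIntoW.holeFromTwoIntoW k₁ k₂ k₁<k₂ k₂<k₁+l (intoW-intro k₁ γ₁ arc₁) (intoW-intro k₂ γ₂ arc₂) i (indeg≤i w) big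
      where open IntoOffH w offH-w

    holeAt-noSharedOffH : ∀ q → inΓ q ≡ false → NoSharedOffH q → HoleInC
    holeAt-noSharedOffH q γq noShared with PAdj? D (v (nextC q)) (v (prevC q))
    ... | no ¬adj = holeAround q γq noShared ¬adj
    ... | yes adj with 4≤sizeC⇒offH-chord 4≤|C| q γq adj
    ...   | w , offH-w , nw , pw = holeFromTwoIntoW w offH-w (nextC q) (prevC q) (nextC<prevC q)
              (<-≤-trans (prevC<x+l q) (+-monoˡ-≤ l (<⇒≤ (x<nextC q)))) (nextC-onC q) nw (prevC-onC q) pw

    holeAt : ∀ q → inΓ q ≡ false → HoleInC
    holeAt q γq with FP.any? (λ w → FP.all? (λ c → ¬? (h c F.≟ w)) ×-dec (D (v q) w B.≟ true))
    ... | no noOffH = holeAt-noSharedOffH q γq (λ w _ offH-w qw _ _ _ _ → noOffH (w , offH-w , qw))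
    ... | yes (w , offH-w , qw)
        with minimalBelow (λ j → inΓ (suc q + j) ≡ false × D (v (suc q + j)) w ≡ true)
                          (λ j → (inΓ (suc q + j) B.≟ false) ×-dec (D (v (suc q + j)) w B.≟ true)) L
    ...   | found j j<L (γ , arc) _ =
      holeFromTwoIntoW w offH-w q (suc q + j) (s≤s (m≤m+n q j)) (suc+<+l q j j<L) γq qw γ arc
    ...   | none noneShares = holeAt-noSharedOffH q γq noShared
      where
      noShared : NoSharedOffH q
      noShared w′ t offH-w′ qw′ q<t t<q+l γt tw′ with window-offset q t q<t t<q+l
      ... | j<L , e = noneShares (t ∸ suc q) j<L
        (subst (λ z → inΓ z ≡ false) (sym e) γt ,
         subst (λ z → D (v z) w ≡ true) (sym e)
           (subst (λ z → D (v t) z ≡ true) (offH-outNeighbour-unique q γq offH-w′ offH-w qw′ qw) tw′))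

    holeInC : HoleInC
    holeInC with countBelow-positive l onC (≤-trans (s≤s z≤n) 4≤|C|)
    ... | q , _ , onC-q = holeAt q (not-injective onC-q)

theorem2p8 : (i : ℕ) → 3 ≤ i → (n : ℕ) → (D : Digraph n) → IJDigraph i 2 D →
    (l : ℕ) → (h : Fin l → Fin n) → IsHole (UAdj D) l h → 5 ≤ l →
    4 ≤ l ∸ ΓSize D h →
    (2 * i + 1 ≤ l ∸ ΓSize D h) ⊎ (l < 3 * ΓSize D h) →
    HasHoleIn (PAdj D) (InC D h)
theorem2p8 i _ n D (acyclic , indeg≤i , outdeg≤2) .(5 + k) h h-hole
           (s≤s (s≤s (s≤s (s≤s (s≤s {n = k} z≤n))))) 4≤|C| cases =
  [ (λ big  → LargeC.holeInC i indeg≤i 4≤sizeC (subst (2 * i + 1 ≤_) l∸ΓSize≡sizeC big))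
  , (λ many → holeIfManyΓ 4≤sizeC (subst (λ c → 5 + k < 3 * c) ΓSize≡countBelow many))
  ]′ cases
  where
  open HoleSetting D (Acyclic⇒loopless {D = D} acyclic) (Acyclic⇒asymmetric {D = D} acyclic) outdeg≤2 k h h-hole
  4≤sizeC : 4 ≤ sizeC
  4≤sizeC = subst (4 ≤_) l∸ΓSize≡sizeC 4≤|C|
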